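{- Let $a, b \ge 1$ be integers such that $3^a + 3^b$ is divisible by $6$, and put $m = \frac{3^a+3^b}{6}$. Then $K_{6m}(x) = x^{6m} + (1-x)^{6m} + 1$ is irreducible over $\mathbb{Q}$. -}

module Defs where

open import Data.Nat using (ℕ; zero; suc)
open import Data.Rational using (ℚ; 0ℚ; 1ℚ; _+_; _*_; -_)
open import Data.List using (List; []; _∷_; map)
open import Data.Product using (∃; _×_)
open import Data.Sum using (_⊎_)
open import Relation.Nullary using (¬_)
open import Relation.Binary.PropositionalEquality using (_≡_)

-- Polynomials over ℚ as coefficient lists, constant term first.
-- Trailing zeros are allowed; equality is coefficientwise.
Poly : Set
Poly = List ℚ

coeff : Poly → ℕ → ℚ
coeff [] _ = 0ℚ
coeff (a ∷ p) zero = a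
coeff (a ∷ p) (suc i) = coeff p i

infix 4 _≈ₚ_
_≈ₚ_ : Poly → Poly → Set
p ≈ₚ q = ∀ i → coeff p i ≡ coeff q i

infixl 6 _+ₚ_
_+ₚ_ : Poly → Poly → Poly
[] +ₚ q = q
(a ∷ p) +ₚ [] = a ∷ p
(a ∷ p) +ₚ (b ∷ q) = (a + b) ∷ (p +ₚ q)

scaleₚ : ℚ → Poly → Poly
scaleₚ c p = map (c *_) p

infixl 7 _*ₚ_
_*ₚ_ : Poly → Poly → Poly
[] *ₚ q = []
(a ∷ p) *ₚ q = scaleₚ a q +ₚ (0ℚ ∷ (p *ₚ q))

constₚ : ℚ → Poly
constₚ c = c ∷ []

oneₚ : Poly
oneₚ = constₚ 1ℚ

Xₚ : Poly
Xₚ = 0ℚ ∷ 1ℚ ∷ []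

infixr 8 _^ₚ_
_^ₚ_ : Poly → ℕ → Poly
p ^ₚ zero = oneₚ
p ^ₚ suc n = p *ₚ (p ^ₚ n)

IsUnit : Poly → Set
IsUnit p = ∃ λ q → p *ₚ q ≈ₚ oneₚ

Irreducible : Poly → Set
Irreducible f = ¬ IsUnit f × (∀ g h → f ≈ₚ g *ₚ h → IsUnit g ⊎ IsUnit h)

K : ℕ → Poly
K n = Xₚ ^ₚ n +ₚ (oneₚ +ₚ scaleₚ (- 1ℚ) Xₚ) ^ₚ n +ₚ oneₚ

-- Substituting x ↦ x − 1 turns K n into F n = (x − 1)ⁿ + (2 − x)ⁿ + 1. For n = 3ᵃ + 3ᵇ the
-- freshman's dream modulo 3 gives (x − 1)^(3ᵃ) ≡ x^(3ᵃ) − 1 and (2 − x)^(3ᵃ) ≡ 2 − x^(3ᵃ), hence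
-- F n ≡ 2 xⁿ (mod 3). Its leading coefficient is 2, and for n = 6 m its constant term 1 + 64ᵐ + 1 is
-- 3 modulo 9, so F n is Eisenstein at 3. Eisenstein's criterion over ℚ, through Gauss's lemma modulo 3
-- and clearing denominators, makes F n and therefore K n irreducible.

module Submission where

open import Data.Nat as ℕ using (ℕ; zero; suc; _<_; _≤_; z≤n; s≤s)
import Data.Nat.Properties as ℕ
import Data.Nat.Divisibility as ℕ∣
import Data.Nat.Coprimality as ℕ
open import Data.Nat.Primality using (Prime; prime?; euclidsLemma; prime⇒nonTrivial; prime⇒nonZero)
open import Data.Integer as ℤ using (ℤ; +_; -[1+_]; 0ℤ; 1ℤ; ∣_∣)
import Data.Integer.Properties as ℤ
import Data.Integer.Solver as ℤ-Solver
open import Data.Integer.Divisibility.Signed as ℤ∣ using (divides; ∣ᵤ⇒∣; ∣⇒∣ᵤ) renaming (_∣_ to _∣ℤ_)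
open import Data.Rational as ℚ using (ℚ; 0ℚ; 1ℚ; mkℚ; ↥_; ↧ₙ_; 1/_)
import Data.Rational.Properties as ℚ
import Data.Rational.Solver as ℚ-Solver
open import Data.Rational.Literals using (fromℤ)
import Data.Rational.Unnormalised as ℚᵘ
import Data.Rational.Unnormalised.Properties as ℚᵘ
open import Data.List using (List; []; _∷_; map)
open import Data.List.Relation.Unary.All using (All; all?; []; _∷_)
open import Data.List.Relation.Unary.Any using (Any; here; there)
open import Data.List.Relation.Unary.All.Properties using (¬All⇒Any¬)
open import Data.Maybe using (Maybe; just; nothing)
open import Data.Product using (Σ; _×_; _,_; proj₁; proj₂)
open import Data.Sum as Sum using (_⊎_; inj₁; inj₂)
open import Data.Empty using (⊥-elim)
open import Function using (_∘_; _$_; id)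
open import Level using (0ℓ)
open import Relation.Nullary using (¬_; Dec; yes; no)
open import Relation.Nullary.Decidable using (from-yes)
open import Relation.Binary.Definitions using (DecidableEquality; tri<; tri≈; tri>)
open import Relation.Binary.PropositionalEquality
open import Relation.Binary.Bundles using (Setoid)
open import Algebra.Structures using (IsCommutativeRing)
open import Algebra.Bundles using (CommutativeRing)
open import Algebra.Solver.Ring.AlmostCommutativeRing using (fromCommutativeRing; _-Raw-AlmostCommutative⟶_)
import Algebra.Solver.Ring as RingSolver
import Defs

module Polynomial {A : Set} {_⊕_ _⊗_ : A → A → A} {⊝_ : A → A} {𝟘 𝟙 : A}
  (isCommutativeRing : IsCommutativeRing _≡_ _⊕_ _⊗_ ⊝_ 𝟘 𝟙) where

  open IsCommutativeRing isCommutativeRing using (+-assoc; +-comm; +-identityˡ; +-identityʳ;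
    -‿inverseʳ; *-assoc; *-comm; *-identityˡ; distribˡ; distribʳ; zeroˡ; zeroʳ)

  infix 4 _≈_
  infixl 6 _+ₚ_
  infixl 7 _*ₚ_
  infixr 8 _^ₚ_
  infixl 9 _∘ₚ_

  Poly : Set
  Poly = List A

  coeff : Poly → ℕ → A
  coeff [] _ = 𝟘
  coeff (a ∷ p) zero = a
  coeff (a ∷ p) (suc i) = coeff p i

  record _≈_ (p q : Poly) : Set where
    constructor mk≈
    field coeff≡ : ∀ i → coeff p i ≡ coeff q i
  open _≈_ public

  _+ₚ_ : Poly → Poly → Poly
  [] +ₚ q = q
  (a ∷ p) +ₚ [] = a ∷ p
  (a ∷ p) +ₚ (b ∷ q) = (a ⊕ b) ∷ (p +ₚ q)

  scaleₚ : A → Poly → Poly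
  scaleₚ c p = map (c ⊗_) p

  _*ₚ_ : Poly → Poly → Poly
  [] *ₚ q = []
  (a ∷ p) *ₚ q = scaleₚ a q +ₚ (𝟘 ∷ (p *ₚ q))

  -ₚ_ : Poly → Poly
  -ₚ_ = map ⊝_

  constₚ : A → Poly
  constₚ c = c ∷ []

  1ₚ : Poly
  1ₚ = constₚ 𝟙

  Xₚ : Poly
  Xₚ = 𝟘 ∷ 𝟙 ∷ []

  _^ₚ_ : Poly → ℕ → Poly
  p ^ₚ zero = 1ₚ
  p ^ₚ suc n = p *ₚ (p ^ₚ n)

  _∘ₚ_ : Poly → Poly → Poly
  [] ∘ₚ s = []
  (a ∷ p) ∘ₚ s = constₚ a +ₚ s *ₚ (p ∘ₚ s)

  ≈-refl : ∀ {p} → p ≈ p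
  ≈-refl = mk≈ λ i → refl

  ≈-sym : ∀ {p q} → p ≈ q → q ≈ p
  ≈-sym e = mk≈ λ i → sym (coeff≡ e i)

  ≈-trans : ∀ {p q r} → p ≈ q → q ≈ r → p ≈ r
  ≈-trans e f = mk≈ λ i → trans (coeff≡ e i) (coeff≡ f i)

  ≈-setoid : Setoid 0ℓ 0ℓ
  ≈-setoid = record { _≈_ = _≈_ ; isEquivalence = record { refl = ≈-refl ; sym = ≈-sym ; trans = ≈-trans } }


  ∷-cong : ∀ {a b p q} → a ≡ b → p ≈ q → a ∷ p ≈ b ∷ q
  ∷-cong e f = mk≈ λ { zero → e ; (suc i) → coeff≡ f i }

  ∷-injectiveʳ : ∀ {a b p q} → a ∷ p ≈ b ∷ q → p ≈ q
  ∷-injectiveʳ e = mk≈ λ i → coeff≡ e (suc i)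

  [𝟘]≈[] : 𝟘 ∷ [] ≈ []
  [𝟘]≈[] = mk≈ λ { zero → refl ; (suc i) → refl }

  ∷≈[]⇒≈[] : ∀ {a p} → a ∷ p ≈ [] → p ≈ []
  ∷≈[]⇒≈[] e = mk≈ λ i → coeff≡ e (suc i)

  coeff-+ₚ : ∀ p q i → coeff (p +ₚ q) i ≡ coeff p i ⊕ coeff q i
  coeff-+ₚ [] q i = sym (+-identityˡ _)
  coeff-+ₚ (a ∷ p) [] i = sym (+-identityʳ _)
  coeff-+ₚ (a ∷ p) (b ∷ q) zero = refl
  coeff-+ₚ (a ∷ p) (b ∷ q) (suc i) = coeff-+ₚ p q i

  coeff-scaleₚ : ∀ c p i → coeff (scaleₚ c p) i ≡ c ⊗ coeff p i
  coeff-scaleₚ c [] i = sym (zeroʳ c)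
  coeff-scaleₚ c (a ∷ p) zero = refl
  coeff-scaleₚ c (a ∷ p) (suc i) = coeff-scaleₚ c p i

  coeff-‿ₚ : ∀ p i → coeff (-ₚ p) i ≡ ⊝ coeff p i
  coeff-‿ₚ [] i = sym (trans (sym (+-identityˡ (⊝ 𝟘))) (-‿inverseʳ 𝟘))
  coeff-‿ₚ (a ∷ p) zero = refl
  coeff-‿ₚ (a ∷ p) (suc i) = coeff-‿ₚ p i

  +ₚ-cong : ∀ {p p′ q q′} → p ≈ p′ → q ≈ q′ → p +ₚ q ≈ p′ +ₚ q′
  +ₚ-cong {p} {p′} {q} {q′} e f = mk≈ λ i →
    trans (coeff-+ₚ p q i) (trans (cong₂ _⊕_ (coeff≡ e i) (coeff≡ f i)) (sym (coeff-+ₚ p′ q′ i)))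

  scaleₚ-cong : ∀ {c d p q} → c ≡ d → p ≈ q → scaleₚ c p ≈ scaleₚ d q
  scaleₚ-cong {c} {d} {p} {q} e f = mk≈ λ i →
    trans (coeff-scaleₚ c p i) (trans (cong₂ _⊗_ e (coeff≡ f i)) (sym (coeff-scaleₚ d q i)))

  -ₚ-cong : ∀ {p q} → p ≈ q → -ₚ p ≈ -ₚ q
  -ₚ-cong {p} {q} f = mk≈ λ i → trans (coeff-‿ₚ p i) (trans (cong ⊝_ (coeff≡ f i)) (sym (coeff-‿ₚ q i)))

  +ₚ-comm : ∀ p q → p +ₚ q ≈ q +ₚ p
  +ₚ-comm p q = mk≈ λ i → trans (coeff-+ₚ p q i) (trans (+-comm _ _) (sym (coeff-+ₚ q p i)))

  +ₚ-assoc : ∀ p q r → (p +ₚ q) +ₚ r ≈ p +ₚ (q +ₚ r)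
  +ₚ-assoc p q r = mk≈ λ i → begin
    coeff ((p +ₚ q) +ₚ r) i                 ≡⟨ coeff-+ₚ (p +ₚ q) r i ⟩
    coeff (p +ₚ q) i ⊕ coeff r i            ≡⟨ cong (_⊕ coeff r i) (coeff-+ₚ p q i) ⟩
    (coeff p i ⊕ coeff q i) ⊕ coeff r i     ≡⟨ +-assoc _ _ _ ⟩
    coeff p i ⊕ (coeff q i ⊕ coeff r i)     ≡⟨ cong (coeff p i ⊕_) (coeff-+ₚ q r i) ⟨
    coeff p i ⊕ coeff (q +ₚ r) i            ≡⟨ coeff-+ₚ p (q +ₚ r) i ⟨
    coeff (p +ₚ (q +ₚ r)) i                 ∎
    where open ≡-Reasoning

  +ₚ-identityʳ : ∀ p → p +ₚ [] ≈ p
  +ₚ-identityʳ p = mk≈ λ i → trans (coeff-+ₚ p [] i) (+-identityʳ _)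

  +ₚ-inverseʳ : ∀ p → p +ₚ -ₚ p ≈ []
  +ₚ-inverseʳ p = mk≈ λ i →
    trans (coeff-+ₚ p (-ₚ p) i) (trans (cong (coeff p i ⊕_) (coeff-‿ₚ p i)) (-‿inverseʳ _))

  +ₚ-interchange : ∀ p q r s → (p +ₚ q) +ₚ (r +ₚ s) ≈ (p +ₚ r) +ₚ (q +ₚ s)
  +ₚ-interchange p q r s = begin
    (p +ₚ q) +ₚ (r +ₚ s)  ≈⟨ +ₚ-assoc p q (r +ₚ s) ⟩
    p +ₚ (q +ₚ (r +ₚ s))  ≈⟨ +ₚ-cong (≈-refl {p}) (+ₚ-assoc q r s) ⟨
    p +ₚ ((q +ₚ r) +ₚ s)  ≈⟨ +ₚ-cong (≈-refl {p}) (+ₚ-cong (+ₚ-comm q r) (≈-refl {s})) ⟩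
    p +ₚ ((r +ₚ q) +ₚ s)  ≈⟨ +ₚ-cong (≈-refl {p}) (+ₚ-assoc r q s) ⟩
    p +ₚ (r +ₚ (q +ₚ s))  ≈⟨ +ₚ-assoc p r (q +ₚ s) ⟨
    (p +ₚ r) +ₚ (q +ₚ s)  ∎
    where open import Relation.Binary.Reasoning.Setoid ≈-setoid

  +ₚ-lcomm : ∀ p q r → p +ₚ (q +ₚ r) ≈ q +ₚ (p +ₚ r)
  +ₚ-lcomm p q r = ≈-trans (≈-sym (+ₚ-assoc p q r)) (≈-trans (+ₚ-cong (+ₚ-comm p q) ≈-refl) (+ₚ-assoc q p r))

  shift-+ₚ : ∀ p q → (𝟘 ∷ p) +ₚ (𝟘 ∷ q) ≈ 𝟘 ∷ (p +ₚ q)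
  shift-+ₚ p q = ∷-cong (+-identityˡ 𝟘) ≈-refl

  scaleₚ-distribˡ : ∀ c p q → scaleₚ c (p +ₚ q) ≈ scaleₚ c p +ₚ scaleₚ c q
  scaleₚ-distribˡ c p q = mk≈ λ i → begin
    coeff (scaleₚ c (p +ₚ q)) i                       ≡⟨ coeff-scaleₚ c (p +ₚ q) i ⟩
    c ⊗ coeff (p +ₚ q) i                              ≡⟨ cong (c ⊗_) (coeff-+ₚ p q i) ⟩
    c ⊗ (coeff p i ⊕ coeff q i)                       ≡⟨ distribˡ c _ _ ⟩
    (c ⊗ coeff p i) ⊕ (c ⊗ coeff q i)                   ≡⟨ cong₂ _⊕_ (coeff-scaleₚ c p i) (coeff-scaleₚ c q i) ⟨
    coeff (scaleₚ c p) i ⊕ coeff (scaleₚ c q) i       ≡⟨ coeff-+ₚ (scaleₚ c p) (scaleₚ c q) i ⟨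
    coeff (scaleₚ c p +ₚ scaleₚ c q) i                ∎
    where open ≡-Reasoning

  scaleₚ-distribʳ : ∀ a b p → scaleₚ (a ⊕ b) p ≈ scaleₚ a p +ₚ scaleₚ b p
  scaleₚ-distribʳ a b p = mk≈ λ i → begin
    coeff (scaleₚ (a ⊕ b) p) i                        ≡⟨ coeff-scaleₚ (a ⊕ b) p i ⟩
    (a ⊕ b) ⊗ coeff p i                               ≡⟨ distribʳ (coeff p i) a b ⟩
    (a ⊗ coeff p i) ⊕ (b ⊗ coeff p i)                   ≡⟨ cong₂ _⊕_ (coeff-scaleₚ a p i) (coeff-scaleₚ b p i) ⟨
    coeff (scaleₚ a p) i ⊕ coeff (scaleₚ b p) i       ≡⟨ coeff-+ₚ (scaleₚ a p) (scaleₚ b p) i ⟨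
    coeff (scaleₚ a p +ₚ scaleₚ b p) i                ∎
    where open ≡-Reasoning

  scaleₚ-scaleₚ : ∀ a b p → scaleₚ a (scaleₚ b p) ≈ scaleₚ (a ⊗ b) p
  scaleₚ-scaleₚ a b p = mk≈ λ i → trans (coeff-scaleₚ a (scaleₚ b p) i)
    (trans (cong (a ⊗_) (coeff-scaleₚ b p i)) (trans (sym (*-assoc a b _)) (sym (coeff-scaleₚ (a ⊗ b) p i))))

  scaleₚ-𝟙 : ∀ p → scaleₚ 𝟙 p ≈ p
  scaleₚ-𝟙 p = mk≈ λ i → trans (coeff-scaleₚ 𝟙 p i) (*-identityˡ _)

  scaleₚ-𝟘 : ∀ p → scaleₚ 𝟘 p ≈ []
  scaleₚ-𝟘 p = mk≈ λ i → trans (coeff-scaleₚ 𝟘 p i) (zeroˡ _)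

  scaleₚ-shift : ∀ c r → scaleₚ c (𝟘 ∷ r) ≈ 𝟘 ∷ scaleₚ c r
  scaleₚ-shift c r = ∷-cong (zeroʳ c) ≈-refl

  *ₚ-zeroˡ : ∀ p q → p ≈ [] → p *ₚ q ≈ []
  *ₚ-zeroˡ [] q e = ≈-refl
  *ₚ-zeroˡ (a ∷ p) q e =
    ≈-trans (+ₚ-cong (scaleₚ-cong (coeff≡ e zero) ≈-refl) (∷-cong refl (*ₚ-zeroˡ p q (∷≈[]⇒≈[] e))))
            (≈-trans (+ₚ-cong (scaleₚ-𝟘 q) ≈-refl) [𝟘]≈[])

  *ₚ-zeroʳ : ∀ p → p *ₚ [] ≈ []
  *ₚ-zeroʳ [] = ≈-refl
  *ₚ-zeroʳ (a ∷ p) = ≈-trans (∷-cong refl (*ₚ-zeroʳ p)) [𝟘]≈[]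

  *ₚ-congˡ : ∀ {p p′} q → p ≈ p′ → p *ₚ q ≈ p′ *ₚ q
  *ₚ-congˡ {[]} {[]} q e = ≈-refl
  *ₚ-congˡ {[]} {b ∷ p′} q e = ≈-sym (*ₚ-zeroˡ (b ∷ p′) q (≈-sym e))
  *ₚ-congˡ {a ∷ p} {[]} q e = *ₚ-zeroˡ (a ∷ p) q e
  *ₚ-congˡ {a ∷ p} {b ∷ p′} q e =
    +ₚ-cong (scaleₚ-cong (coeff≡ e zero) ≈-refl) (∷-cong refl (*ₚ-congˡ q (∷-injectiveʳ e)))

  *ₚ-congʳ : ∀ p {q q′} → q ≈ q′ → p *ₚ q ≈ p *ₚ q′
  *ₚ-congʳ [] e = ≈-refl
  *ₚ-congʳ (a ∷ p) e = +ₚ-cong (scaleₚ-cong refl e) (∷-cong refl (*ₚ-congʳ p e))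

  *ₚ-cong : ∀ {p p′ q q′} → p ≈ p′ → q ≈ q′ → p *ₚ q ≈ p′ *ₚ q′
  *ₚ-cong {p} {p′} {q} e f = ≈-trans (*ₚ-congˡ q e) (*ₚ-congʳ p′ f)

  *ₚ-distribʳ : ∀ q p p′ → (p +ₚ p′) *ₚ q ≈ p *ₚ q +ₚ p′ *ₚ q
  *ₚ-distribʳ q [] p′ = ≈-refl
  *ₚ-distribʳ q (a ∷ p) [] = ≈-sym (+ₚ-identityʳ _)
  *ₚ-distribʳ q (a ∷ p) (b ∷ p′) =
    ≈-trans (+ₚ-cong (scaleₚ-distribʳ a b q)
                     (≈-trans (∷-cong refl (*ₚ-distribʳ q p p′)) (≈-sym (shift-+ₚ (p *ₚ q) (p′ *ₚ q)))))
            (+ₚ-interchange (scaleₚ a q) (scaleₚ b q) (𝟘 ∷ (p *ₚ q)) (𝟘 ∷ (p′ *ₚ q)))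

  *ₚ-distribˡ : ∀ p q q′ → p *ₚ (q +ₚ q′) ≈ p *ₚ q +ₚ p *ₚ q′
  *ₚ-distribˡ [] q q′ = ≈-refl
  *ₚ-distribˡ (a ∷ p) q q′ =
    ≈-trans (+ₚ-cong (scaleₚ-distribˡ a q q′)
                     (≈-trans (∷-cong refl (*ₚ-distribˡ p q q′)) (≈-sym (shift-+ₚ (p *ₚ q) (p *ₚ q′)))))
            (+ₚ-interchange (scaleₚ a q) (scaleₚ a q′) (𝟘 ∷ (p *ₚ q)) (𝟘 ∷ (p *ₚ q′)))

  *ₚ-identityˡ : ∀ q → 1ₚ *ₚ q ≈ q
  *ₚ-identityˡ q = ≈-trans (+ₚ-cong (scaleₚ-𝟙 q) [𝟘]≈[]) (+ₚ-identityʳ q)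

  Xₚ-*ₚ : ∀ p → Xₚ *ₚ p ≈ 𝟘 ∷ p
  Xₚ-*ₚ p = +ₚ-cong (scaleₚ-𝟘 p) (∷-cong refl (*ₚ-identityˡ p))

  shift-*ₚ : ∀ s r → (𝟘 ∷ s) *ₚ r ≈ 𝟘 ∷ (s *ₚ r)
  shift-*ₚ s r = +ₚ-cong (scaleₚ-𝟘 r) ≈-refl

  scaleₚ-*ₚ : ∀ c p q → scaleₚ c p *ₚ q ≈ scaleₚ c (p *ₚ q)
  scaleₚ-*ₚ c [] q = ≈-refl
  scaleₚ-*ₚ c (a ∷ p) q =
    ≈-trans (+ₚ-cong (≈-sym (scaleₚ-scaleₚ c a q)) (∷-cong refl (scaleₚ-*ₚ c p q)))
            (≈-sym (≈-trans (scaleₚ-distribˡ c (scaleₚ a q) (𝟘 ∷ (p *ₚ q))) (+ₚ-cong ≈-refl (scaleₚ-shift c _))))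

  *ₚ-assoc : ∀ p q r → (p *ₚ q) *ₚ r ≈ p *ₚ (q *ₚ r)
  *ₚ-assoc [] q r = ≈-refl
  *ₚ-assoc (a ∷ p) q r =
    ≈-trans (*ₚ-distribʳ r (scaleₚ a q) (𝟘 ∷ (p *ₚ q)))
            (+ₚ-cong (scaleₚ-*ₚ a q r) (≈-trans (shift-*ₚ (p *ₚ q) r) (∷-cong refl (*ₚ-assoc p q r))))

  *ₚ-∷ : ∀ p b q → p *ₚ (b ∷ q) ≈ scaleₚ b p +ₚ (𝟘 ∷ (p *ₚ q))
  *ₚ-∷ [] b q = ≈-sym [𝟘]≈[]
  *ₚ-∷ (a ∷ p) b q =
    ∷-cong (trans (+-identityʳ _) (trans (*-comm a b) (sym (+-identityʳ _))))
           (≈-trans (+ₚ-cong ≈-refl (*ₚ-∷ p b q)) (+ₚ-lcomm (scaleₚ a q) (scaleₚ b p) _))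

  *ₚ-comm : ∀ p q → p *ₚ q ≈ q *ₚ p
  *ₚ-comm p [] = *ₚ-zeroʳ p
  *ₚ-comm p (b ∷ q) = ≈-trans (*ₚ-∷ p b q) (+ₚ-cong ≈-refl (∷-cong refl (*ₚ-comm p q)))

  *ₚ-identityʳ : ∀ q → q *ₚ 1ₚ ≈ q
  *ₚ-identityʳ q = ≈-trans (*ₚ-comm q 1ₚ) (*ₚ-identityˡ q)

  *ₚ-lcomm : ∀ p q r → p *ₚ (q *ₚ r) ≈ q *ₚ (p *ₚ r)
  *ₚ-lcomm p q r = ≈-trans (≈-sym (*ₚ-assoc p q r)) (≈-trans (*ₚ-congˡ r (*ₚ-comm p q)) (*ₚ-assoc q p r))

  scaleₚ-*ₚ-scaleₚ : ∀ a b p q → scaleₚ a p *ₚ scaleₚ b q ≈ scaleₚ (a ⊗ b) (p *ₚ q)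
  scaleₚ-*ₚ-scaleₚ a b p q = begin
    scaleₚ a p *ₚ scaleₚ b q        ≈⟨ scaleₚ-*ₚ a p (scaleₚ b q) ⟩
    scaleₚ a (p *ₚ scaleₚ b q)      ≈⟨ scaleₚ-cong refl (*ₚ-comm p (scaleₚ b q)) ⟩
    scaleₚ a (scaleₚ b q *ₚ p)      ≈⟨ scaleₚ-cong refl (scaleₚ-*ₚ b q p) ⟩
    scaleₚ a (scaleₚ b (q *ₚ p))    ≈⟨ scaleₚ-scaleₚ a b (q *ₚ p) ⟩
    scaleₚ (a ⊗ b) (q *ₚ p)         ≈⟨ scaleₚ-cong refl (*ₚ-comm q p) ⟩
    scaleₚ (a ⊗ b) (p *ₚ q)         ∎
    where open import Relation.Binary.Reasoning.Setoid ≈-setoid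

  constₚ-*ₚ : ∀ c p → constₚ c *ₚ p ≈ scaleₚ c p
  constₚ-*ₚ c p = ≈-trans (+ₚ-cong ≈-refl [𝟘]≈[]) (+ₚ-identityʳ _)

  isCommutativeRingₚ : IsCommutativeRing _≈_ _+ₚ_ _*ₚ_ -ₚ_ [] 1ₚ
  isCommutativeRingₚ = record
    { isRing = record
      { +-isAbelianGroup = record
        { isGroup = record
          { isMonoid = record
            { isSemigroup = record
              { isMagma = record { isEquivalence = Setoid.isEquivalence ≈-setoid ; ∙-cong = +ₚ-cong }
              ; assoc = +ₚ-assoc }
            ; identity = (λ p → ≈-refl) , +ₚ-identityʳ }
          ; inverse = (λ p → ≈-trans (+ₚ-comm (-ₚ p) p) (+ₚ-inverseʳ p)) , +ₚ-inverseʳ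
          ; ⁻¹-cong = -ₚ-cong }
        ; comm = +ₚ-comm }
      ; *-cong = *ₚ-cong
      ; *-assoc = *ₚ-assoc
      ; *-identity = *ₚ-identityˡ , *ₚ-identityʳ
      ; distrib = *ₚ-distribˡ , *ₚ-distribʳ }
    ; *-comm = *ₚ-comm }

  commutativeRingₚ : CommutativeRing 0ℓ 0ℓ
  commutativeRingₚ = record { isCommutativeRing = isCommutativeRingₚ }

  Degree≤ : Poly → ℕ → Set
  Degree≤ p d = ∀ i → d < i → coeff p i ≡ 𝟘

  IsConstant : Poly → Set
  IsConstant p = Degree≤ p 0

  IsUnit : Poly → Set
  IsUnit p = Σ Poly λ r → p *ₚ r ≈ 1ₚ

  Irreducible : Poly → Set
  Irreducible f = ¬ IsUnit f × (∀ g h → f ≈ g *ₚ h → IsUnit g ⊎ IsUnit h)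

  coeff-*ₚ-∷ : ∀ a p q k → coeff ((a ∷ p) *ₚ q) k ≡ (a ⊗ coeff q k) ⊕ coeff (𝟘 ∷ (p *ₚ q)) k
  coeff-*ₚ-∷ a p q k = trans (coeff-+ₚ (scaleₚ a q) _ k) (cong (_⊕ _) (coeff-scaleₚ a q k))

  coeff-*ₚ-0 : ∀ p q → coeff (p *ₚ q) 0 ≡ coeff p 0 ⊗ coeff q 0
  coeff-*ₚ-0 [] q = sym (zeroˡ _)
  coeff-*ₚ-0 (a ∷ p) q = trans (coeff-*ₚ-∷ a p q 0) (+-identityʳ _)

  coeff-constₚ-*ₚ : ∀ c p k → coeff (constₚ c *ₚ p) k ≡ c ⊗ coeff p k
  coeff-constₚ-*ₚ c p k = trans (coeff≡ (constₚ-*ₚ c p) k) (coeff-scaleₚ c p k)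

  *ₚ-leading : ∀ p q {d e} → Degree≤ p d → Degree≤ q e →
               Degree≤ (p *ₚ q) (d ℕ.+ e) × coeff (p *ₚ q) (d ℕ.+ e) ≡ coeff p d ⊗ coeff q e
  *ₚ-leading [] q hp hq = (λ k _ → refl) , sym (zeroˡ _)
  *ₚ-leading (a ∷ p) q {zero} {e} hp hq = above , at-top
    where
    p≈[] : p ≈ []
    p≈[] = mk≈ λ i → hp (suc i) (s≤s z≤n)
    shift≈[] : ∀ k → coeff (𝟘 ∷ (p *ₚ q)) k ≡ 𝟘
    shift≈[] zero = refl
    shift≈[] (suc k) = coeff≡ (*ₚ-zeroˡ p q p≈[]) k
    above : Degree≤ ((a ∷ p) *ₚ q) e
    above k e<k = trans (coeff-*ₚ-∷ a p q k)
      (trans (cong₂ _⊕_ (trans (cong (a ⊗_) (hq k e<k)) (zeroʳ a)) (shift≈[] k)) (+-identityˡ 𝟘))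
    at-top : coeff ((a ∷ p) *ₚ q) e ≡ a ⊗ coeff q e
    at-top = trans (coeff-*ₚ-∷ a p q e) (trans (cong (_ ⊕_) (shift≈[] e)) (+-identityʳ _))
  *ₚ-leading (a ∷ p) q {suc d} {e} hp hq = above , at-top
    where
    ih = *ₚ-leading p q {d} {e} (λ i d<i → hp (suc i) (s≤s d<i)) hq
    a*q≈0 : ∀ k → d ℕ.+ e < k → a ⊗ coeff q (suc k) ≡ 𝟘
    a*q≈0 k d+e<k = trans (cong (a ⊗_) (hq (suc k) (s≤s (ℕ.≤-trans (ℕ.m≤n+m e d) (ℕ.<⇒≤ d+e<k))))) (zeroʳ a)
    above : Degree≤ ((a ∷ p) *ₚ q) (suc d ℕ.+ e)
    above (suc k) (s≤s d+e<k) =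
      trans (coeff-*ₚ-∷ a p q (suc k)) (trans (cong₂ _⊕_ (a*q≈0 k d+e<k) (proj₁ ih k d+e<k)) (+-identityˡ 𝟘))
    at-top : coeff ((a ∷ p) *ₚ q) (suc d ℕ.+ e) ≡ coeff p d ⊗ coeff q e
    at-top = trans (coeff-*ₚ-∷ a p q (suc (d ℕ.+ e)))
      (trans (cong₂ _⊕_ (trans (cong (a ⊗_) (hq _ (s≤s (ℕ.m≤n+m e d)))) (zeroʳ a)) (proj₂ ih)) (+-identityˡ _))

  infixr 8 _^_
  _^_ : A → ℕ → A
  x ^ zero = 𝟙
  x ^ suc n = x ⊗ (x ^ n)

  ^-+ : ∀ x m n → x ^ (m ℕ.+ n) ≡ (x ^ m) ⊗ (x ^ n)
  ^-+ x zero n = sym (*-identityˡ _)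
  ^-+ x (suc m) n = trans (cong (x ⊗_) (^-+ x m n)) (sym (*-assoc _ _ _))

  ^-* : ∀ x m n → x ^ (n ℕ.* m) ≡ (x ^ m) ^ n
  ^-* x m zero = refl
  ^-* x m (suc n) = trans (^-+ x m (n ℕ.* m)) (cong ((x ^ m) ⊗_) (^-* x m n))

  𝟙^n≡𝟙 : ∀ n → 𝟙 ^ n ≡ 𝟙
  𝟙^n≡𝟙 zero = refl
  𝟙^n≡𝟙 (suc n) = trans (*-identityˡ _) (𝟙^n≡𝟙 n)

  ^ₚ-cong : ∀ {p q} n → p ≈ q → p ^ₚ n ≈ q ^ₚ n
  ^ₚ-cong zero e = ≈-refl
  ^ₚ-cong (suc n) e = *ₚ-cong e (^ₚ-cong n e)

  ^ₚ-+ : ∀ p m n → p ^ₚ (m ℕ.+ n) ≈ p ^ₚ m *ₚ p ^ₚ n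
  ^ₚ-+ p zero n = ≈-sym (*ₚ-identityˡ _)
  ^ₚ-+ p (suc m) n = ≈-trans (*ₚ-congʳ p (^ₚ-+ p m n)) (≈-sym (*ₚ-assoc p _ _))

  ^ₚ-* : ∀ p m n → p ^ₚ (n ℕ.* m) ≈ (p ^ₚ m) ^ₚ n
  ^ₚ-* p m zero = ≈-refl
  ^ₚ-* p m (suc n) = ≈-trans (^ₚ-+ p m (n ℕ.* m)) (*ₚ-congʳ (p ^ₚ m) (^ₚ-* p m n))

  ^ₚ-distrib-*ₚ : ∀ p q n → (p *ₚ q) ^ₚ n ≈ p ^ₚ n *ₚ q ^ₚ n
  ^ₚ-distrib-*ₚ p q zero = ≈-sym (*ₚ-identityˡ 1ₚ)
  ^ₚ-distrib-*ₚ p q (suc n) =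
    ≈-trans (*ₚ-congʳ (p *ₚ q) (^ₚ-distrib-*ₚ p q n))
    (≈-trans (*ₚ-assoc p q _) (≈-trans (*ₚ-congʳ p (*ₚ-lcomm q (p ^ₚ n) (q ^ₚ n))) (≈-sym (*ₚ-assoc p _ _))))

  coeff-^ₚ-0 : ∀ p n → coeff (p ^ₚ n) 0 ≡ coeff p 0 ^ n
  coeff-^ₚ-0 p zero = refl
  coeff-^ₚ-0 p (suc n) = trans (coeff-*ₚ-0 p (p ^ₚ n)) (cong (coeff p 0 ⊗_) (coeff-^ₚ-0 p n))

  ^ₚ-leading : ∀ p → Degree≤ p 1 → ∀ n → Degree≤ (p ^ₚ n) n × coeff (p ^ₚ n) n ≡ coeff p 1 ^ n
  ^ₚ-leading p hp zero = (λ { (suc k) _ → refl }) , refl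
  ^ₚ-leading p hp (suc n) = proj₁ top , trans (proj₂ top) (cong (coeff p 1 ⊗_) (proj₂ ih))
    where
    ih = ^ₚ-leading p hp n
    top = *ₚ-leading p (p ^ₚ n) hp (proj₁ ih)

  Xₚ^ₚ-suc : ∀ n → Xₚ ^ₚ suc n ≈ 𝟘 ∷ Xₚ ^ₚ n
  Xₚ^ₚ-suc n = Xₚ-*ₚ (Xₚ ^ₚ n)

  coeff-Xₚ^ₚ-≢ : ∀ n k → k ≢ n → coeff (Xₚ ^ₚ n) k ≡ 𝟘
  coeff-Xₚ^ₚ-≢ zero zero k≢n = ⊥-elim (k≢n refl)
  coeff-Xₚ^ₚ-≢ zero (suc k) k≢n = refl
  coeff-Xₚ^ₚ-≢ (suc n) zero k≢n = coeff≡ (Xₚ^ₚ-suc n) 0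
  coeff-Xₚ^ₚ-≢ (suc n) (suc k) k≢n = trans (coeff≡ (Xₚ^ₚ-suc n) (suc k)) (coeff-Xₚ^ₚ-≢ n k (λ e → k≢n (cong suc e)))

  ∘ₚ-zeroˡ : ∀ p s → p ≈ [] → p ∘ₚ s ≈ []
  ∘ₚ-zeroˡ [] s e = ≈-refl
  ∘ₚ-zeroˡ (a ∷ p) s e =
    ≈-trans (+ₚ-cong (∷-cong (coeff≡ e 0) ≈-refl) (≈-trans (*ₚ-congʳ s (∘ₚ-zeroˡ p s (∷≈[]⇒≈[] e))) (*ₚ-zeroʳ s)))
            (≈-trans (+ₚ-identityʳ _) [𝟘]≈[])

  ∘ₚ-congˡ : ∀ {p p′} s → p ≈ p′ → p ∘ₚ s ≈ p′ ∘ₚ s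
  ∘ₚ-congˡ {[]} {[]} s e = ≈-refl
  ∘ₚ-congˡ {[]} {b ∷ p′} s e = ≈-sym (∘ₚ-zeroˡ (b ∷ p′) s (≈-sym e))
  ∘ₚ-congˡ {a ∷ p} {[]} s e = ∘ₚ-zeroˡ (a ∷ p) s e
  ∘ₚ-congˡ {a ∷ p} {b ∷ p′} s e = +ₚ-cong (∷-cong (coeff≡ e 0) ≈-refl) (*ₚ-congʳ s (∘ₚ-congˡ s (∷-injectiveʳ e)))

  ∘ₚ-congʳ : ∀ p {s s′} → s ≈ s′ → p ∘ₚ s ≈ p ∘ₚ s′
  ∘ₚ-congʳ [] e = ≈-refl
  ∘ₚ-congʳ (a ∷ p) e = +ₚ-cong ≈-refl (*ₚ-cong e (∘ₚ-congʳ p e))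

  +ₚ-∘ₚ : ∀ p q s → (p +ₚ q) ∘ₚ s ≈ p ∘ₚ s +ₚ q ∘ₚ s
  +ₚ-∘ₚ [] q s = ≈-refl
  +ₚ-∘ₚ (a ∷ p) [] s = ≈-sym (+ₚ-identityʳ _)
  +ₚ-∘ₚ (a ∷ p) (b ∷ q) s =
    ≈-trans (+ₚ-cong ≈-refl (≈-trans (*ₚ-congʳ s (+ₚ-∘ₚ p q s)) (*ₚ-distribˡ s _ _)))
            (+ₚ-interchange (constₚ a) (constₚ b) (s *ₚ (p ∘ₚ s)) (s *ₚ (q ∘ₚ s)))

  scaleₚ-∘ₚ : ∀ c p s → scaleₚ c p ∘ₚ s ≈ constₚ c *ₚ (p ∘ₚ s)
  scaleₚ-∘ₚ c [] s = ≈-sym (*ₚ-zeroʳ (constₚ c))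
  scaleₚ-∘ₚ c (a ∷ p) s =
    ≈-trans (+ₚ-cong (≈-sym (constₚ-*ₚ c (constₚ a)))
                     (≈-trans (*ₚ-congʳ s (scaleₚ-∘ₚ c p s)) (*ₚ-lcomm s (constₚ c) _)))
            (≈-sym (*ₚ-distribˡ (constₚ c) (constₚ a) (s *ₚ (p ∘ₚ s))))

  *ₚ-∘ₚ : ∀ p q s → (p *ₚ q) ∘ₚ s ≈ p ∘ₚ s *ₚ q ∘ₚ s
  *ₚ-∘ₚ [] q s = ≈-refl
  *ₚ-∘ₚ (a ∷ p) q s = begin
    (scaleₚ a q +ₚ (𝟘 ∷ (p *ₚ q))) ∘ₚ s             ≈⟨ +ₚ-∘ₚ (scaleₚ a q) (𝟘 ∷ (p *ₚ q)) s ⟩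
    scaleₚ a q ∘ₚ s +ₚ (𝟘 ∷ (p *ₚ q)) ∘ₚ s          ≈⟨ +ₚ-cong (scaleₚ-∘ₚ a q s) (+ₚ-cong [𝟘]≈[] ≈-refl) ⟩
    constₚ a *ₚ q ∘ₚ s +ₚ s *ₚ ((p *ₚ q) ∘ₚ s)      ≈⟨ +ₚ-cong ≈-refl (*ₚ-congʳ s (*ₚ-∘ₚ p q s)) ⟩
    constₚ a *ₚ q ∘ₚ s +ₚ s *ₚ (p ∘ₚ s *ₚ q ∘ₚ s)  ≈⟨ +ₚ-cong ≈-refl (*ₚ-assoc s _ _) ⟨
    constₚ a *ₚ q ∘ₚ s +ₚ s *ₚ p ∘ₚ s *ₚ q ∘ₚ s    ≈⟨ *ₚ-distribʳ (q ∘ₚ s) (constₚ a) (s *ₚ (p ∘ₚ s)) ⟨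
    (a ∷ p) ∘ₚ s *ₚ q ∘ₚ s                         ∎
    where open import Relation.Binary.Reasoning.Setoid ≈-setoid

  constₚ-∘ₚ : ∀ c s → constₚ c ∘ₚ s ≈ constₚ c
  constₚ-∘ₚ c s = ≈-trans (+ₚ-cong ≈-refl (*ₚ-zeroʳ s)) (+ₚ-identityʳ _)

  Xₚ-∘ₚ : ∀ s → Xₚ ∘ₚ s ≈ s
  Xₚ-∘ₚ s = +ₚ-cong [𝟘]≈[] (≈-trans (*ₚ-congʳ s (constₚ-∘ₚ 𝟙 s)) (*ₚ-identityʳ s))

  ^ₚ-∘ₚ : ∀ p n s → (p ^ₚ n) ∘ₚ s ≈ (p ∘ₚ s) ^ₚ n
  ^ₚ-∘ₚ p zero s = constₚ-∘ₚ 𝟙 s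
  ^ₚ-∘ₚ p (suc n) s = ≈-trans (*ₚ-∘ₚ p (p ^ₚ n) s) (*ₚ-congʳ (p ∘ₚ s) (^ₚ-∘ₚ p n s))

  ∘ₚ-assoc : ∀ g s t → (g ∘ₚ s) ∘ₚ t ≈ g ∘ₚ (s ∘ₚ t)
  ∘ₚ-assoc [] s t = ≈-refl
  ∘ₚ-assoc (a ∷ g) s t =
    ≈-trans (+ₚ-∘ₚ (constₚ a) (s *ₚ (g ∘ₚ s)) t)
            (+ₚ-cong (constₚ-∘ₚ a t) (≈-trans (*ₚ-∘ₚ s (g ∘ₚ s) t) (*ₚ-congʳ (s ∘ₚ t) (∘ₚ-assoc g s t))))

  ∘ₚ-identityʳ : ∀ g → g ∘ₚ Xₚ ≈ g
  ∘ₚ-identityʳ [] = ≈-refl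
  ∘ₚ-identityʳ (a ∷ g) =
    ≈-trans (+ₚ-cong (≈-refl {constₚ a}) (≈-trans (Xₚ-*ₚ (g ∘ₚ Xₚ)) (∷-cong refl (∘ₚ-identityʳ g))))
            (∷-cong (+-identityʳ a) ≈-refl)

  IsUnit-resp-≈ : ∀ {p q} → p ≈ q → IsUnit p → IsUnit q
  IsUnit-resp-≈ e (r , pr≈1) = r , ≈-trans (*ₚ-congˡ r (≈-sym e)) pr≈1

  Irreducible-resp-≈ : ∀ {f f′} → f ≈ f′ → Irreducible f → Irreducible f′
  Irreducible-resp-≈ f≈f′ (¬unit , factors) =
    ¬unit ∘ IsUnit-resp-≈ (≈-sym f≈f′) , λ g h f′≈gh → factors g h (≈-trans f≈f′ f′≈gh)

  IsUnit-∘ₚ : ∀ p s → IsUnit p → IsUnit (p ∘ₚ s)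
  IsUnit-∘ₚ p s (r , pr≈1) = r ∘ₚ s ,
    ≈-trans (≈-sym (*ₚ-∘ₚ p r s)) (≈-trans (∘ₚ-congˡ s pr≈1) (constₚ-∘ₚ 𝟙 s))

  -- g ↦ g ∘ₚ s is multiplicative, and g ↦ g ∘ₚ t undoes it.
  irreducible-∘ₚ⁻ : ∀ {f} s t → s ∘ₚ t ≈ Xₚ → Irreducible (f ∘ₚ s) → Irreducible f
  irreducible-∘ₚ⁻ {f} s t st≈X (¬unit , factors) = ¬unit ∘ IsUnit-∘ₚ f s , factorsᶠ
    where
    undo : ∀ g → (g ∘ₚ s) ∘ₚ t ≈ g
    undo g = ≈-trans (∘ₚ-assoc g s t) (≈-trans (∘ₚ-congʳ g st≈X) (∘ₚ-identityʳ g))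
    unit⇐ : ∀ g → IsUnit (g ∘ₚ s) → IsUnit g
    unit⇐ g = IsUnit-resp-≈ (undo g) ∘ IsUnit-∘ₚ (g ∘ₚ s) t
    factorsᶠ : ∀ g h → f ≈ g *ₚ h → IsUnit g ⊎ IsUnit h
    factorsᶠ g h f≈gh with factors (g ∘ₚ s) (h ∘ₚ s) (≈-trans (∘ₚ-congˡ s f≈gh) (*ₚ-∘ₚ g h s))
    ... | inj₁ u = inj₁ (unit⇐ g u)
    ... | inj₂ u = inj₂ (unit⇐ h u)

  module IntegralDomain (_≟_ : DecidableEquality A) (𝟙≢𝟘 : 𝟙 ≢ 𝟘)
    (zero-product : ∀ x y → x ⊗ y ≡ 𝟘 → x ≡ 𝟘 ⊎ y ≡ 𝟘) where

    ≈[]? : ∀ p → Dec (p ≈ [])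
    ≈[]? [] = yes ≈-refl
    ≈[]? (a ∷ p) with a ≟ 𝟘 | ≈[]? p
    ... | yes a≡𝟘 | yes p≈[] = yes (≈-trans (∷-cong a≡𝟘 p≈[]) [𝟘]≈[])
    ... | no a≢𝟘 | _ = no (λ e → a≢𝟘 (coeff≡ e 0))
    ... | yes _ | no p≉[] = no (p≉[] ∘ ∷≈[]⇒≈[])

    degree : ∀ p → ¬ p ≈ [] → Σ ℕ λ d → coeff p d ≢ 𝟘 × Degree≤ p d
    degree [] p≉[] = ⊥-elim (p≉[] ≈-refl)
    degree (a ∷ p) a∷p≉[] with ≈[]? p
    ... | yes p≈[] =
      0 , (λ a≡𝟘 → a∷p≉[] (≈-trans (∷-cong a≡𝟘 p≈[]) [𝟘]≈[])) , (λ { (suc i) _ → coeff≡ p≈[] i })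
    ... | no p≉[] with degree p p≉[]
    ...   | d , p[d]≢𝟘 , p≤d = suc d , p[d]≢𝟘 , (λ { (suc i) (s≤s d<i) → p≤d i d<i })

    constant-if-product-bounded : ∀ {g h n} → coeff h n ≢ 𝟘 → Degree≤ (g *ₚ h) n → IsConstant g
    constant-if-product-bounded {g} {h} {n} h[n]≢𝟘 gh≤n with ≈[]? g
    ... | yes g≈[] = λ i _ → coeff≡ g≈[] i
    ... | no g≉[] with degree g g≉[] | degree h (λ h≈[] → h[n]≢𝟘 (coeff≡ h≈[] n))
    ...   | zero , _ , g≤0 | _ = g≤0
    ...   | suc d , g[d]≢𝟘 , g≤d | e , h[e]≢𝟘 , h≤e
          with zero-product _ _ (trans (sym (proj₂ (*ₚ-leading g h g≤d h≤e))) (gh≤n (suc d ℕ.+ e) n<1+d+e))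
      where
      n≤e : n ℕ.≤ e
      n≤e with n ℕ.≤? e
      ... | yes n≤e = n≤e
      ... | no n≰e = ⊥-elim (h[n]≢𝟘 (h≤e n (ℕ.≰⇒> n≰e)))
      n<1+d+e : n < suc d ℕ.+ e
      n<1+d+e = s≤s (ℕ.≤-trans n≤e (ℕ.m≤n+m e d))
    ...     | inj₁ g[d]≡𝟘 = ⊥-elim (g[d]≢𝟘 g[d]≡𝟘)
    ...     | inj₂ h[e]≡𝟘 = ⊥-elim (h[e]≢𝟘 h[e]≡𝟘)

    unit⇒constant : ∀ p → IsUnit p → IsConstant p
    unit⇒constant p (r , pr≈1) with ≈[]? r
    ... | yes r≈[] = ⊥-elim (𝟙≢𝟘 (coeff≡ (≈-trans (≈-sym pr≈1) (≈-trans (*ₚ-congʳ p r≈[]) (*ₚ-zeroʳ p))) 0))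
    ... | no r≉[] with degree r r≉[]
    ...   | d , r[d]≢𝟘 , _ = constant-if-product-bounded {p} {r} r[d]≢𝟘 (λ { (suc i) _ → coeff≡ pr≈1 (suc i) })

module ℤ[x] = Polynomial ℤ.+-*-isCommutativeRing
module ℚ[x] = Polynomial ℚ.+-*-isCommutativeRing

ι : ℤ → ℚ
ι = fromℤ

ι-+ : ∀ a b → ι (a ℤ.+ b) ≡ ι a ℚ.+ ι b
ι-+ a b = ℚ.toℚᵘ-injective (ℚᵘ.≃-trans (ℚᵘ.*≡* cross-products) (ℚᵘ.≃-sym (ℚ.toℚᵘ-homo-+ (ι a) (ι b))))
  where
  open ℤ-Solver.+-*-Solver
  cross-products : (a ℤ.+ b) ℤ.* + 1 ≡ (a ℤ.* + 1 ℤ.+ b ℤ.* + 1) ℤ.* + 1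
  cross-products = solve 2 (λ a b → (a :+ b) :* con (+ 1) := (a :* con (+ 1) :+ b :* con (+ 1)) :* con (+ 1)) refl a b

ι-* : ∀ a b → ι (a ℤ.* b) ≡ ι a ℚ.* ι b
ι-* a b = ℚ.toℚᵘ-injective (ℚᵘ.≃-sym (ℚ.toℚᵘ-homo-* (ι a) (ι b)))

ι-injective : ∀ {a b} → ι a ≡ ι b → a ≡ b
ι-injective = cong ↥_

ι-denominator : ∀ r → r ℚ.* ι (+ ↧ₙ r) ≡ ι (↥ r)
ι-denominator r@(mkℚ n d _) = ℚ.toℚᵘ-injective (ℚᵘ.≃-trans (ℚ.toℚᵘ-homo-* r (ι (+ ↧ₙ r)))
  (ℚᵘ.*≡* (trans (ℤ.*-identityʳ _) (cong (λ x → n ℤ.* + x) (sym (ℕ.*-identityʳ (suc d)))))))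

embed : ℤ[x].Poly → ℚ[x].Poly
embed = map ι

coeff-embed : ∀ p i → ℚ[x].coeff (embed p) i ≡ ι (ℤ[x].coeff p i)
coeff-embed [] i = refl
coeff-embed (a ∷ p) zero = refl
coeff-embed (a ∷ p) (suc i) = coeff-embed p i

embed-+ₚ : ∀ p q → embed (p ℤ[x].+ₚ q) ≡ embed p ℚ[x].+ₚ embed q
embed-+ₚ [] q = refl
embed-+ₚ (a ∷ p) [] = refl
embed-+ₚ (a ∷ p) (b ∷ q) = cong₂ _∷_ (ι-+ a b) (embed-+ₚ p q)

embed-scaleₚ : ∀ c p → embed (ℤ[x].scaleₚ c p) ≡ ℚ[x].scaleₚ (ι c) (embed p)
embed-scaleₚ c [] = refl
embed-scaleₚ c (a ∷ p) = cong₂ _∷_ (ι-* c a) (embed-scaleₚ c p)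

embed-*ₚ : ∀ p q → embed (p ℤ[x].*ₚ q) ≡ embed p ℚ[x].*ₚ embed q
embed-*ₚ [] q = refl
embed-*ₚ (a ∷ p) q = trans (embed-+ₚ (ℤ[x].scaleₚ a q) (0ℤ ∷ (p ℤ[x].*ₚ q)))
  (cong₂ ℚ[x]._+ₚ_ (embed-scaleₚ a q) (cong (0ℚ ∷_) (embed-*ₚ p q)))

embed-^ₚ : ∀ p n → embed (p ℤ[x].^ₚ n) ≡ embed p ℚ[x].^ₚ n
embed-^ₚ p zero = refl
embed-^ₚ p (suc n) = trans (embed-*ₚ p (p ℤ[x].^ₚ n)) (cong (embed p ℚ[x].*ₚ_) (embed-^ₚ p n))

embed-cong : ∀ {p q} → p ℤ[x].≈ q → embed p ℚ[x].≈ embed q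
embed-cong {p} {q} e = ℚ[x].mk≈ λ i → trans (coeff-embed p i) (trans (cong ι (ℤ[x].coeff≡ e i)) (sym (coeff-embed q i)))

embed-injective : ∀ {p q} → embed p ℚ[x].≈ embed q → p ℤ[x].≈ q
embed-injective {p} {q} e = ℤ[x].mk≈ λ i →
  ι-injective (trans (sym (coeff-embed p i)) (trans (ℚ[x].coeff≡ e i) (coeff-embed q i)))

ℤ-zero-product : ∀ x y → x ℤ.* y ≡ 0ℤ → x ≡ 0ℤ ⊎ y ≡ 0ℤ
ℤ-zero-product x y = ℤ.i*j≡0⇒i≡0∨j≡0 x

1ℤ≢0ℤ : 1ℤ ≢ 0ℤ
1ℤ≢0ℤ ()

module ℤ[x]-Domain = ℤ[x].IntegralDomain ℤ._≟_ 1ℤ≢0ℤ ℤ-zero-product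

module Congruence where
  open ℤ[x] using (Poly; _≈_; _+ₚ_; _*ₚ_; _^ₚ_; -ₚ_; constₚ; ≈-refl; ≈-sym; ≈-trans)

  constₚ-morphism : CommutativeRing.rawRing ℤ.+-*-commutativeRing -Raw-AlmostCommutative⟶ fromCommutativeRing ℤ[x].commutativeRingₚ
  constₚ-morphism = record
    { ⟦_⟧ = constₚ
    ; +-homo = λ a b → ≈-refl
    ; *-homo = λ a b → ℤ[x].∷-cong (sym (ℤ.+-identityʳ _)) ≈-refl
    ; -‿homo = λ a → ≈-refl
    ; 0-homo = ℤ[x].[𝟘]≈[]
    ; 1-homo = ≈-refl
    }

  constₚ-≟ : ∀ x y → Maybe (constₚ x ≈ constₚ y)
  constₚ-≟ x y with x ℤ.≟ y
  ... | yes refl = just ≈-refl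
  ... | no _ = nothing

  module ℤ[x]-Solver = RingSolver (CommutativeRing.rawRing ℤ.+-*-commutativeRing)
    (fromCommutativeRing ℤ[x].commutativeRingₚ) constₚ-morphism constₚ-≟

  open ℤ[x]-Solver using (solve; _:=_; con; _:+_; _:*_; :-_)

  infix 4 _≈_[mod_]
  record _≈_[mod_] (P Q : Poly) (c : ℤ) : Set where
    constructor mk≈mod
    field
      quotient : Poly
      ≈+multiple : P ≈ Q +ₚ constₚ c *ₚ quotient

  module _ {c : ℤ} where

    ≈⇒≈mod : ∀ {P Q} → P ≈ Q → P ≈ Q [mod c ]
    ≈⇒≈mod {P} {Q} e = mk≈mod [] $
      ≈-trans e (≈-sym (≈-trans (ℤ[x].+ₚ-cong (≈-refl {Q}) (ℤ[x].*ₚ-zeroʳ (constₚ c))) (ℤ[x].+ₚ-identityʳ Q)))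

    ≈mod-trans : ∀ {P Q S} → P ≈ Q [mod c ] → Q ≈ S [mod c ] → P ≈ S [mod c ]
    ≈mod-trans {P} {Q} {S} (mk≈mod R e) (mk≈mod R′ e′) = mk≈mod (R′ +ₚ R) $
      ≈-trans e (≈-trans (ℤ[x].+ₚ-cong e′ ≈-refl)
        (solve 4 (λ c s r r′ → (s :+ c :* r′) :+ c :* r := s :+ c :* (r′ :+ r)) ≈-refl (constₚ c) S R R′))

    +ₚ-cong-mod : ∀ {P P′ Q Q′} → P ≈ P′ [mod c ] → Q ≈ Q′ [mod c ] → P +ₚ Q ≈ P′ +ₚ Q′ [mod c ]
    +ₚ-cong-mod {P} {P′} {Q} {Q′} (mk≈mod R e) (mk≈mod S f) = mk≈mod (R +ₚ S) $
      ≈-trans (ℤ[x].+ₚ-cong e f)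
        (solve 5 (λ c p q r s → (p :+ c :* r) :+ (q :+ c :* s) := (p :+ q) :+ c :* (r :+ s)) ≈-refl (constₚ c) P′ Q′ R S)

    *ₚ-cong-mod : ∀ {P P′ Q Q′} → P ≈ P′ [mod c ] → Q ≈ Q′ [mod c ] → P *ₚ Q ≈ P′ *ₚ Q′ [mod c ]
    *ₚ-cong-mod {P} {P′} {Q} {Q′} (mk≈mod R e) (mk≈mod S f) = mk≈mod (R *ₚ Q′ +ₚ P′ *ₚ S +ₚ constₚ c *ₚ R *ₚ S) $
      ≈-trans (ℤ[x].*ₚ-cong e f)
        (solve 5 (λ c p q r s → (p :+ c :* r) :* (q :+ c :* s) := (p :* q) :+ c :* (r :* q :+ p :* s :+ c :* r :* s))
               ≈-refl (constₚ c) P′ Q′ R S)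

    ^ₚ-cong-mod : ∀ {P Q} n → P ≈ Q [mod c ] → P ^ₚ n ≈ Q ^ₚ n [mod c ]
    ^ₚ-cong-mod zero e = ≈⇒≈mod ≈-refl
    ^ₚ-cong-mod (suc n) e = *ₚ-cong-mod e (^ₚ-cong-mod n e)

    ≈mod-coeff-∣ : ∀ {P Q} → P ≈ Q [mod c ] → ∀ k → c ∣ℤ ℤ[x].coeff Q k → c ∣ℤ ℤ[x].coeff P k
    ≈mod-coeff-∣ {P} {Q} (mk≈mod R e) k c∣Qk =
      subst (c ∣ℤ_) (sym coeff-P) (ℤ∣.∣m∣n⇒∣m+n c∣Qk (ℤ∣.∣m⇒∣m*n _ ℤ∣.∣-refl))
      where
      coeff-P : ℤ[x].coeff P k ≡ ℤ[x].coeff Q k ℤ.+ c ℤ.* ℤ[x].coeff R k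
      coeff-P = trans (ℤ[x].coeff≡ e k)
        (trans (ℤ[x].coeff-+ₚ Q _ k) (cong (λ x → ℤ[x].coeff Q k ℤ.+ x) (ℤ[x].coeff-constₚ-*ₚ c R k)))

  freshmans-dream-cube : ∀ p q → (p +ₚ q) ^ₚ 3 ≈ p ^ₚ 3 +ₚ q ^ₚ 3 [mod + 3 ]
  freshmans-dream-cube p q = mk≈mod (p *ₚ p *ₚ q +ₚ p *ₚ q *ₚ q) $
    solve 2 (λ p q → (p :+ q) :* ((p :+ q) :* ((p :+ q) :* con (+ 1))) :=
                     (p :* (p :* (p :* con (+ 1))) :+ q :* (q :* (q :* con (+ 1)))) :+ con (+ 3) :* (p :* p :* q :+ p :* q :* q))
            ≈-refl p q

  ^ₚ-3^suc : ∀ p a → p ^ₚ (3 ℕ.^ suc a) ≈ (p ^ₚ (3 ℕ.^ a)) ^ₚ 3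
  ^ₚ-3^suc p a = ℤ[x].^ₚ-* p (3 ℕ.^ a) 3

  freshmans-dream : ∀ a p q → (p +ₚ q) ^ₚ (3 ℕ.^ a) ≈ p ^ₚ (3 ℕ.^ a) +ₚ q ^ₚ (3 ℕ.^ a) [mod + 3 ]
  freshmans-dream zero p q = ≈⇒≈mod (≈-trans (ℤ[x].*ₚ-identityʳ _)
    (ℤ[x].+ₚ-cong (≈-sym (ℤ[x].*ₚ-identityʳ p)) (≈-sym (ℤ[x].*ₚ-identityʳ q))))
  freshmans-dream (suc a) p q =
    ≈mod-trans (≈⇒≈mod (^ₚ-3^suc (p +ₚ q) a))
    (≈mod-trans (^ₚ-cong-mod 3 (freshmans-dream a p q))
    (≈mod-trans (freshmans-dream-cube (p ^ₚ (3 ℕ.^ a)) (q ^ₚ (3 ℕ.^ a)))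
                (≈⇒≈mod (ℤ[x].+ₚ-cong (≈-sym (^ₚ-3^suc p a)) (≈-sym (^ₚ-3^suc q a))))))

  fermat : ∀ a {r} → r ^ₚ 3 ≈ r [mod + 3 ] → r ^ₚ (3 ℕ.^ a) ≈ r [mod + 3 ]
  fermat zero {r} _ = ≈⇒≈mod (ℤ[x].*ₚ-identityʳ r)
  fermat (suc a) {r} r³≈r = ≈mod-trans (≈⇒≈mod (^ₚ-3^suc r a)) (≈mod-trans (^ₚ-cong-mod 3 (fermat a r³≈r)) r³≈r)

open Congruence

module Eisenstein (℘ : ℕ) (℘-prime : Prime ℘) where
  open ℤ[x] using (Poly; coeff; _≈_; _*ₚ_; scaleₚ; Degree≤; IsConstant; ≈-sym; ≈-trans; coeff≡)

  ℘∣_ : ℤ → Set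
  ℘∣ x = + ℘ ∣ℤ x

  ℘∣? : ∀ x → Dec (℘∣ x)
  ℘∣? x = + ℘ ℤ∣.∣? x

  ℘∣0 : ℘∣ 0ℤ
  ℘∣0 = divides 0ℤ refl

  ℘∤⇒≢0 : ∀ {x} → ¬ ℘∣ x → x ≢ 0ℤ
  ℘∤⇒≢0 ℘∤x refl = ℘∤x ℘∣0

  ℘∣-euclid : ∀ x y → ℘∣ (x ℤ.* y) → ℘∣ x ⊎ ℘∣ y
  ℘∣-euclid x y ℘∣xy with euclidsLemma ∣ x ∣ ∣ y ∣ ℘-prime (subst (℘ ℕ∣.∣_) (ℤ.abs-* x y) (∣⇒∣ᵤ ℘∣xy))
  ... | inj₁ ℘∣x = inj₁ (∣ᵤ⇒∣ ℘∣x)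
  ... | inj₂ ℘∣y = inj₂ (∣ᵤ⇒∣ ℘∣y)

  ℘∤-* : ∀ {x y} → ¬ ℘∣ x → ¬ ℘∣ y → ¬ ℘∣ (x ℤ.* y)
  ℘∤-* {x} {y} ℘∤x ℘∤y ℘∣xy with ℘∣-euclid x y ℘∣xy
  ... | inj₁ ℘∣x = ℘∤x ℘∣x
  ... | inj₂ ℘∣y = ℘∤y ℘∣y

  ℘-Primitive : Poly → Set
  ℘-Primitive G = Σ ℕ λ i → ¬ ℘∣ coeff G i

  LowestIndivisible : Poly → ℕ → Set
  LowestIndivisible p i₀ = (∀ i → i < i₀ → ℘∣ coeff p i) × ¬ ℘∣ coeff p i₀

  lowest-indivisible : ∀ p → ℘-Primitive p → Σ ℕ (LowestIndivisible p)
  lowest-indivisible [] (i , ℘∤0) = ⊥-elim (℘∤0 ℘∣0)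
  lowest-indivisible (a ∷ p) (i , ℘∤p[i]) with ℘∣? a | i
  ... | no ℘∤a | _ = 0 , (λ _ ()) , ℘∤a
  ... | yes ℘∣a | zero = ⊥-elim (℘∤p[i] ℘∣a)
  ... | yes ℘∣a | suc i′ with lowest-indivisible p (i′ , ℘∤p[i])
  ...   | i₀ , below , at = suc i₀ , (λ { zero _ → ℘∣a ; (suc i) (s≤s i<i₀) → below i i<i₀ }) , at

  ℘∣-*ₚ-∷ : ∀ a p q k → ℘∣ (a ℤ.* coeff q k) → ℘∣ coeff (0ℤ ∷ (p *ₚ q)) k → ℘∣ coeff ((a ∷ p) *ₚ q) k
  ℘∣-*ₚ-∷ a p q k ℘∣aq ℘∣pq = subst ℘∣_ (sym (ℤ[x].coeff-*ₚ-∷ a p q k)) (ℤ∣.∣m∣n⇒∣m+n ℘∣aq ℘∣pq)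

  *ₚ-divisible-below : ∀ r {q j₀} → (∀ j → j < j₀ → ℘∣ coeff q j) → ∀ k → k < j₀ → ℘∣ coeff (r *ₚ q) k
  *ₚ-divisible-below [] hq k k<j₀ = ℘∣0
  *ₚ-divisible-below (b ∷ r) {q} hq k k<j₀ = ℘∣-*ₚ-∷ b r q k (ℤ∣.∣n⇒∣m*n b (hq k k<j₀)) (shifted k k<j₀)
    where
    shifted : ∀ k → k < _ → ℘∣ coeff (0ℤ ∷ (r *ₚ q)) k
    shifted zero _ = ℘∣0
    shifted (suc k) k+1<j₀ = *ₚ-divisible-below r hq k (ℕ.<-trans (ℕ.n<1+n k) k+1<j₀)

  *ₚ-lowest-indivisible : ∀ p {q i₀ j₀} → LowestIndivisible p i₀ → LowestIndivisible q j₀ →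
                          LowestIndivisible (p *ₚ q) (i₀ ℕ.+ j₀)
  *ₚ-lowest-indivisible [] (_ , ℘∤0) _ = ⊥-elim (℘∤0 ℘∣0)
  *ₚ-lowest-indivisible (a ∷ p) {q} {zero} {j₀} (_ , ℘∤a) (below , ℘∤q[j₀]) = below′ , at
    where
    shifted : ∀ k → k < suc j₀ → ℘∣ coeff (0ℤ ∷ (p *ₚ q)) k
    shifted zero _ = ℘∣0
    shifted (suc k) (s≤s k<j₀) = *ₚ-divisible-below p below k k<j₀
    below′ : ∀ k → k < j₀ → ℘∣ coeff ((a ∷ p) *ₚ q) k
    below′ k k<j₀ = ℘∣-*ₚ-∷ a p q k (ℤ∣.∣n⇒∣m*n a (below k k<j₀)) (shifted k (ℕ.m<n⇒m<1+n k<j₀))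
    at : ¬ ℘∣ coeff ((a ∷ p) *ₚ q) j₀
    at ℘∣c = ℘∤-* ℘∤a ℘∤q[j₀]
      (ℤ∣.∣m+n∣n⇒∣m (subst ℘∣_ (ℤ[x].coeff-*ₚ-∷ a p q j₀) ℘∣c) (shifted j₀ ℕ.≤-refl))
  *ₚ-lowest-indivisible (a ∷ p) {q} {suc i₀} {j₀} (below , ℘∤p[i₀]) lowest-q = below′ , at
    where
    ih = *ₚ-lowest-indivisible p ((λ i i<i₀ → below (suc i) (s≤s i<i₀)) , ℘∤p[i₀]) lowest-q
    ℘∣a : ℘∣ a
    ℘∣a = below 0 (s≤s z≤n)
    below′ : ∀ k → k < suc i₀ ℕ.+ j₀ → ℘∣ coeff ((a ∷ p) *ₚ q) k
    below′ zero _ = ℘∣-*ₚ-∷ a p q 0 (ℤ∣.∣m⇒∣m*n _ ℘∣a) ℘∣0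
    below′ (suc k) (s≤s k<s) = ℘∣-*ₚ-∷ a p q (suc k) (ℤ∣.∣m⇒∣m*n _ ℘∣a) (proj₁ ih k k<s)
    at : ¬ ℘∣ coeff ((a ∷ p) *ₚ q) (suc i₀ ℕ.+ j₀)
    at ℘∣c = proj₂ ih (ℤ∣.∣m+n∣m⇒∣n (subst ℘∣_ (ℤ[x].coeff-*ₚ-∷ a p q _) ℘∣c) (ℤ∣.∣m⇒∣m*n _ ℘∣a))

  all-divisible⇒scaleₚ : ∀ P → All ℘∣_ P → Σ Poly λ P′ → P ≡ scaleₚ (+ ℘) P′
  all-divisible⇒scaleₚ [] [] = [] , refl
  all-divisible⇒scaleₚ (a ∷ P) (divides q a≡q℘ ∷ rest) with all-divisible⇒scaleₚ P rest
  ... | P′ , P≡℘P′ = q ∷ P′ , cong₂ _∷_ (trans a≡q℘ (ℤ.*-comm q (+ ℘))) P≡℘P′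

  some-indivisible⇒℘-Primitive : ∀ {P} → Any (¬_ ∘ ℘∣_) P → ℘-Primitive P
  some-indivisible⇒℘-Primitive (here ℘∤a) = 0 , ℘∤a
  some-indivisible⇒℘-Primitive (there any) with some-indivisible⇒℘-Primitive any
  ... | i , ℘∤P[i] = suc i , ℘∤P[i]

  -- Divide by ℘ while possible; N is fuel, as each division shrinks the nonzero coefficient ∣ coeff P i ∣ ≤ N.
  primitive-part : ∀ N P i → ∣ coeff P i ∣ ≤ N → coeff P i ≢ 0ℤ →
                   Σ ℤ λ c → Σ Poly λ G → P ≈ scaleₚ c G × ℘-Primitive G
  primitive-part N P i ∣P[i]∣≤N P[i]≢0 with all? ℘∣? P
  ... | no ¬all = + 1 , P , ≈-sym (ℤ[x].scaleₚ-𝟙 P) , some-indivisible⇒℘-Primitive (¬All⇒Any¬ ℘∣? P ¬all)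
  ... | yes all with all-divisible⇒scaleₚ P all
  ...   | P′ , refl with N
  ...     | zero = ⊥-elim (P[i]≢0 (ℤ.∣i∣≡0⇒i≡0 (ℕ.n≤0⇒n≡0 ∣P[i]∣≤N)))
  ...     | suc N′ with primitive-part N′ P′ i ∣P′[i]∣≤N′ (P[i]≢0 ∘ ℘*-≡0)
    where
    P′[i] = coeff P′ i
    ℘*-≡0 : P′[i] ≡ 0ℤ → coeff (scaleₚ (+ ℘) P′) i ≡ 0ℤ
    ℘*-≡0 P′[i]≡0 = trans (ℤ[x].coeff-scaleₚ (+ ℘) P′ i) (trans (cong (+ ℘ ℤ.*_) P′[i]≡0) (ℤ.*-zeroʳ (+ ℘)))
    instance
      ∣P′[i]∣≢0 : ℕ.NonZero ∣ P′[i] ∣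
      ∣P′[i]∣≢0 = ℕ.≢-nonZero (P[i]≢0 ∘ ℘*-≡0 ∘ ℤ.∣i∣≡0⇒i≡0)
    ℘>1 : 1 < ℘
    ℘>1 = ℕ.nonTrivial⇒n>1 ℘ {{prime⇒nonTrivial ℘-prime}}
    ∣P′[i]∣≤N′ : ∣ P′[i] ∣ ≤ N′
    ∣P′[i]∣≤N′ = ℕ.≤-pred (begin-strict
      ∣ P′[i] ∣                        <⟨ ℕ.m<m*n ∣ P′[i] ∣ ℘ ℘>1 ⟩
      ∣ P′[i] ∣ ℕ.* ℘                  ≡⟨ ℕ.*-comm _ ℘ ⟩
      ℘ ℕ.* ∣ P′[i] ∣                  ≡⟨ ℤ.abs-* (+ ℘) P′[i] ⟨
      ∣ + ℘ ℤ.* P′[i] ∣                ≡⟨ cong ∣_∣ (ℤ[x].coeff-scaleₚ (+ ℘) P′ i) ⟨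
      ∣ coeff (scaleₚ (+ ℘) P′) i ∣    ≤⟨ ∣P[i]∣≤N ⟩
      suc N′                           ∎)
      where open ℕ.≤-Reasoning
  ...       | c , G , P′≈cG , prim = + ℘ ℤ.* c , G ,
              ≈-trans (ℤ[x].scaleₚ-cong {+ ℘} refl P′≈cG) (ℤ[x].scaleₚ-scaleₚ (+ ℘) c G) , prim

  primitive-decomposition : ∀ P → ¬ P ≈ [] → Σ ℤ λ c → Σ Poly λ G → P ≈ scaleₚ c G × ℘-Primitive G
  primitive-decomposition P P≉[] with ℤ[x]-Domain.degree P P≉[]
  ... | d , P[d]≢0 , _ = primitive-part ∣ coeff P d ∣ P d ℕ.≤-refl P[d]≢0

  ℘² : ℤ
  ℘² = + ℘ ℤ.* + ℘

  ℘²∣-* : ∀ {x y} → ℘∣ x → ℘∣ y → ℘² ∣ℤ x ℤ.* y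
  ℘²∣-* {x} ℘∣x ℘∣y = ℤ∣.∣-trans (ℤ∣.*-monoˡ-∣ (+ ℘) ℘∣x) (ℤ∣.*-monoʳ-∣ x ℘∣y)

  ℘²∣-cancel : ∀ {q f} → ¬ ℘∣ q → ℘∣ f → ℘² ∣ℤ q ℤ.* f → ℘² ∣ℤ f
  ℘²∣-cancel {q} ℘∤q (divides w refl) ℘²∣qf with ℘∣-euclid q w ℘∣qw
    where
    instance _ = prime⇒nonZero ℘-prime
    ℘∣qw : ℘∣ (q ℤ.* w)
    ℘∣qw = ℤ∣.*-cancelʳ-∣ (+ ℘) (subst (℘² ∣ℤ_) (sym (ℤ.*-assoc q w (+ ℘))) ℘²∣qf)
  ... | inj₁ ℘∣q = ⊥-elim (℘∤q ℘∣q)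
  ... | inj₂ ℘∣w = ℤ∣.*-monoˡ-∣ (+ ℘) ℘∣w

  record IsEisenstein (F : Poly) (n : ℕ) : Set where
    field
      positive-degree : 0 < n
      degree≤ : Degree≤ F n
      leading-indivisible : ¬ ℘∣ coeff F n
      lower-divisible : ∀ k → k < n → ℘∣ coeff F k
      constant-not-℘²-divisible : ¬ ℘² ∣ℤ coeff F 0

  module EisensteinArgument {F n G H p q} (eis : IsEisenstein F n) (coprime : ¬ (℘∣ p × ℘∣ q))
                            (qF≈pGH : scaleₚ q F ≈ scaleₚ p (G *ₚ H)) where
    open IsEisenstein eis

    qF≡pGH : ∀ k → q ℤ.* coeff F k ≡ p ℤ.* coeff (G *ₚ H) k
    qF≡pGH k = trans (sym (ℤ[x].coeff-scaleₚ q F k)) (trans (coeff≡ qF≈pGH k) (ℤ[x].coeff-scaleₚ p (G *ₚ H) k))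

    divisible-off-n : ∀ k → k ≢ n → ℘∣ coeff F k
    divisible-off-n k k≢n with ℕ.<-cmp k n
    ... | tri< k<n _ _ = lower-divisible k k<n
    ... | tri≈ _ k≡n _ = ⊥-elim (k≢n k≡n)
    ... | tri> _ _ n<k = subst ℘∣_ (sym (degree≤ k n<k)) ℘∣0

    ℘∤p : ¬ ℘∣ p
    ℘∤p ℘∣p with ℘∣-euclid q (coeff F n) (subst ℘∣_ (sym (qF≡pGH n)) (ℤ∣.∣m⇒∣m*n _ ℘∣p))
    ... | inj₁ ℘∣q = coprime (℘∣p , ℘∣q)
    ... | inj₂ ℘∣F[n] = leading-indivisible ℘∣F[n]

    GH≤n : Degree≤ (G *ₚ H) n
    GH≤n k n<k with ℤ.i*j≡0⇒i≡0∨j≡0 p (trans (sym (qF≡pGH k)) (trans (cong (q ℤ.*_) (degree≤ k n<k)) (ℤ.*-zeroʳ q)))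
    ... | inj₁ p≡0 = ⊥-elim (℘∤⇒≢0 ℘∤p p≡0)
    ... | inj₂ GH[k]≡0 = GH[k]≡0

    module _ {s} (lowest : LowestIndivisible (G *ₚ H) s) where

      ℘∤qF[s] : ¬ ℘∣ (q ℤ.* coeff F s)
      ℘∤qF[s] ℘∣qF[s] = ℘∤-* ℘∤p (proj₂ lowest) (subst ℘∣_ (qF≡pGH s) ℘∣qF[s])

      ℘∤q : ¬ ℘∣ q
      ℘∤q = ℘∤qF[s] ∘ ℤ∣.∣m⇒∣m*n _

      lowest≡n : s ≡ n
      lowest≡n with s ℕ.≟ n
      ... | yes s≡n = s≡n
      ... | no s≢n = ⊥-elim (℘∤qF[s] (ℤ∣.∣n⇒∣m*n q (divisible-off-n s s≢n)))

      ℘²∤GH[0] : ¬ ℘² ∣ℤ coeff (G *ₚ H) 0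
      ℘²∤GH[0] ℘²∣GH[0] = constant-not-℘²-divisible
        (℘²∣-cancel ℘∤q (divisible-off-n 0 (ℕ.<⇒≢ positive-degree))
                    (subst (℘² ∣ℤ_) (sym (qF≡pGH 0)) (ℤ∣.∣n⇒∣m*n p ℘²∣GH[0])))

  -- The form in which the criterion meets a factorisation over ℚ: q F = p G H with p / q in lowest terms.
  eisenstein : ∀ {F n G H p q} → IsEisenstein F n → ℘-Primitive G → ℘-Primitive H → ¬ (℘∣ p × ℘∣ q) →
               scaleₚ q F ≈ scaleₚ p (G *ₚ H) → IsConstant G ⊎ IsConstant H
  eisenstein {F} {n} {G} {H} eis primG primH coprime qF≈pGH =
    conclude (lowest-indivisible G primG) (lowest-indivisible H primH)
    where
    open EisensteinArgument {G = G} {H = H} eis coprime qF≈pGH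
    HG≤n : Degree≤ (H *ₚ G) n
    HG≤n k n<k = trans (coeff≡ (ℤ[x].*ₚ-comm H G) k) (GH≤n k n<k)
    conclude : Σ ℕ (LowestIndivisible G) → Σ ℕ (LowestIndivisible H) → IsConstant G ⊎ IsConstant H
    conclude (zero , lowestG) (j₀ , lowestH) = inj₁ (ℤ[x]-Domain.constant-if-product-bounded {G} {H} H[n]≢0 GH≤n)
      where
      H[n]≢0 : coeff H n ≢ 0ℤ
      H[n]≢0 = ℘∤⇒≢0 (subst (λ j → ¬ ℘∣ coeff H j) (lowest≡n (*ₚ-lowest-indivisible G lowestG lowestH)) (proj₂ lowestH))
    conclude (suc i₀ , lowestG) (zero , lowestH) = inj₂ (ℤ[x]-Domain.constant-if-product-bounded {H} {G} G[n]≢0 HG≤n)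
      where
      i₀+0≡n = lowest≡n (*ₚ-lowest-indivisible G lowestG lowestH)
      G[n]≢0 : coeff G n ≢ 0ℤ
      G[n]≢0 = ℘∤⇒≢0 (subst (λ i → ¬ ℘∣ coeff G i) (trans (sym (ℕ.+-identityʳ _)) i₀+0≡n) (proj₂ lowestG))
    conclude (suc i₀ , lowestG) (suc j₀ , lowestH) =
      ⊥-elim (℘²∤GH[0] (*ₚ-lowest-indivisible G lowestG lowestH)
                (subst (℘² ∣ℤ_) (sym (ℤ[x].coeff-*ₚ-0 G H))
                       (℘²∣-* (proj₁ lowestG 0 (s≤s z≤n)) (proj₁ lowestH 0 (s≤s z≤n)))))

module RationalFactorisation where
  open ℚ[x] using (Poly; coeff; _≈_; _*ₚ_; scaleₚ; constₚ; IsUnit; IsConstant; Irreducible; ≈-refl; ≈-trans; coeff≡; mk≈)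

  ℚ-zero-product : ∀ x y → x ℚ.* y ≡ 0ℚ → x ≡ 0ℚ ⊎ y ≡ 0ℚ
  ℚ-zero-product x y xy≡0 with x ℚ.≟ 0ℚ
  ... | yes x≡0 = inj₁ x≡0
  ... | no x≢0 = inj₂ (begin
      y                    ≡⟨ ℚ.*-identityˡ y ⟨
      1ℚ ℚ.* y             ≡⟨ cong (ℚ._* y) (ℚ.*-inverseˡ x) ⟨
      (1/ x ℚ.* x) ℚ.* y   ≡⟨ ℚ.*-assoc (1/ x) x y ⟩
      1/ x ℚ.* (x ℚ.* y)   ≡⟨ cong (1/ x ℚ.*_) xy≡0 ⟩
      1/ x ℚ.* 0ℚ          ≡⟨ ℚ.*-zeroʳ (1/ x) ⟩
      0ℚ                   ∎)
    where
    open ≡-Reasoning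
    instance _ = ℚ.≢-nonZero x≢0

  module ℚ[x]-Domain = ℚ[x].IntegralDomain ℚ._≟_ ℚ.1≢0 ℚ-zero-product

  constant⇒unit : ∀ g → ¬ g ≈ [] → IsConstant g → IsUnit g
  constant⇒unit [] []≉[] _ = ⊥-elim ([]≉[] ≈-refl)
  constant⇒unit (c ∷ g) c∷g≉[] const = constₚ (1/ c) ,
    ≈-trans (ℚ[x].*ₚ-congˡ (constₚ (1/ c)) c∷g≈[c]) (ℚ[x].∷-cong (trans (ℚ.+-identityʳ _) (ℚ.*-inverseʳ c)) ≈-refl)
    where
    c∷g≈[c] : c ∷ g ≈ constₚ c
    c∷g≈[c] = mk≈ λ { zero → refl ; (suc i) → const (suc i) (s≤s z≤n) }
    c≢0 : c ≢ 0ℚ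
    c≢0 c≡0 = c∷g≉[] (mk≈ λ { zero → c≡0 ; (suc i) → const (suc i) (s≤s z≤n) })
    instance _ = ℚ.≢-nonZero c≢0

  ι-≢0 : ∀ {d} → d ≢ 0ℤ → ι d ≢ 0ℚ
  ι-≢0 d≢0 = d≢0 ∘ ι-injective

  clear-denominators : ∀ g → Σ ℤ λ d → Σ ℤ[x].Poly λ G → d ≢ 0ℤ × scaleₚ (ι d) g ≈ embed G
  clear-denominators [] = 1ℤ , [] , (λ ()) , ≈-refl
  clear-denominators (a ∷ g) with clear-denominators g
  ... | d , G , d≢0 , dg≈G = e ℤ.* d , (d ℤ.* ↥ a) ∷ ℤ[x].scaleₚ e G , ed≢0 , ℚ[x].∷-cong head tail
    where
    e = + ↧ₙ a
    ed≢0 : e ℤ.* d ≢ 0ℤ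
    ed≢0 ed≡0 with ℤ.i*j≡0⇒i≡0∨j≡0 e ed≡0
    ... | inj₁ ()
    ... | inj₂ d≡0 = d≢0 d≡0
    head : ι (e ℤ.* d) ℚ.* a ≡ ι (d ℤ.* ↥ a)
    head = begin
      ι (e ℤ.* d) ℚ.* a          ≡⟨ cong (ℚ._* a) (ι-* e d) ⟩
      (ι e ℚ.* ι d) ℚ.* a        ≡⟨ solve 3 (λ x y a → (x :* y) :* a := y :* (a :* x)) refl (ι e) (ι d) a ⟩
      ι d ℚ.* (a ℚ.* ι e)        ≡⟨ cong (ι d ℚ.*_) (ι-denominator a) ⟩
      ι d ℚ.* ι (↥ a)            ≡⟨ ι-* d (↥ a) ⟨
      ι (d ℤ.* ↥ a)              ∎
      where
      open ≡-Reasoning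
      open ℚ-Solver.+-*-Solver
    tail : scaleₚ (ι (e ℤ.* d)) g ≈ embed (ℤ[x].scaleₚ e G)
    tail = begin
      scaleₚ (ι (e ℤ.* d)) g            ≈⟨ ℚ[x].scaleₚ-cong (ι-* e d) ≈-refl ⟩
      scaleₚ (ι e ℚ.* ι d) g            ≈⟨ ℚ[x].scaleₚ-scaleₚ (ι e) (ι d) g ⟨
      scaleₚ (ι e) (scaleₚ (ι d) g)     ≈⟨ ℚ[x].scaleₚ-cong {ι e} refl dg≈G ⟩
      scaleₚ (ι e) (embed G)            ≡⟨ embed-scaleₚ e G ⟨
      embed (ℤ[x].scaleₚ e G)           ∎
      where open import Relation.Binary.Reasoning.Setoid ℚ[x].≈-setoid

  cross-multiply : ∀ Λ {F GH} → embed F ≈ scaleₚ Λ (embed GH) →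
                   ℤ[x].scaleₚ (+ ↧ₙ Λ) F ℤ[x].≈ ℤ[x].scaleₚ (↥ Λ) GH
  cross-multiply Λ {F} {GH} F≈ΛGH = embed-injective (begin
    embed (ℤ[x].scaleₚ (+ ↧ₙ Λ) F)             ≡⟨ embed-scaleₚ (+ ↧ₙ Λ) F ⟩
    scaleₚ (ι (+ ↧ₙ Λ)) (embed F)              ≈⟨ ℚ[x].scaleₚ-cong {ι (+ ↧ₙ Λ)} refl F≈ΛGH ⟩
    scaleₚ (ι (+ ↧ₙ Λ)) (scaleₚ Λ (embed GH))  ≈⟨ ℚ[x].scaleₚ-scaleₚ (ι (+ ↧ₙ Λ)) Λ (embed GH) ⟩
    scaleₚ (ι (+ ↧ₙ Λ) ℚ.* Λ) (embed GH)       ≡⟨ cong (λ x → scaleₚ x (embed GH)) ↧Λ*Λ≡↥Λ ⟩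
    scaleₚ (ι (↥ Λ)) (embed GH)                ≡⟨ embed-scaleₚ (↥ Λ) GH ⟨
    embed (ℤ[x].scaleₚ (↥ Λ) GH)               ∎)
    where
    open import Relation.Binary.Reasoning.Setoid ℚ[x].≈-setoid
    ↧Λ*Λ≡↥Λ : ι (+ ↧ₙ Λ) ℚ.* Λ ≡ ι (↥ Λ)
    ↧Λ*Λ≡↥Λ = trans (ℚ.*-comm (ι (+ ↧ₙ Λ)) Λ) (ι-denominator Λ)

  IsConstant-scaleₚ-embed : ∀ {g} c G → g ≈ scaleₚ c (embed G) → ℤ[x].IsConstant G → IsConstant g
  IsConstant-scaleₚ-embed {g} c G g≈cG G-const i 0<i = begin
    coeff g i                            ≡⟨ coeff≡ g≈cG i ⟩
    coeff (scaleₚ c (embed G)) i         ≡⟨ ℚ[x].coeff-scaleₚ c (embed G) i ⟩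
    c ℚ.* coeff (embed G) i              ≡⟨ cong (c ℚ.*_) (coeff-embed G i) ⟩
    c ℚ.* ι (ℤ[x].coeff G i)             ≡⟨ cong (λ x → c ℚ.* ι x) (G-const i 0<i) ⟩
    c ℚ.* 0ℚ                             ≡⟨ ℚ.*-zeroʳ c ⟩
    0ℚ                                   ∎
    where open ≡-Reasoning

  module EisensteinOverℚ (℘ : ℕ) (℘-prime : Prime ℘) where
    open Eisenstein ℘ ℘-prime

    IntegralForm : Poly → Set
    IntegralForm g = Σ ℚ λ c → Σ ℤ[x].Poly λ G → g ≈ scaleₚ c (embed G) × ℘-Primitive G

    integral-form : ∀ g → ¬ g ≈ [] → IntegralForm g
    integral-form g g≉[] with clear-denominators g
    ... | d , G₀ , d≢0 , dg≈G₀ with primitive-decomposition G₀ G₀≉[]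
      where
      G₀≉[] : ¬ G₀ ℤ[x].≈ []
      G₀≉[] G₀≈[] = g≉[] (mk≈ λ i →
        Sum.[ ⊥-elim ∘ ι-≢0 d≢0 , id ]′ (ℚ-zero-product (ι d) (coeff g i) (dg[i]≡0 i)))
        where
        dg[i]≡0 : ∀ i → ι d ℚ.* coeff g i ≡ 0ℚ
        dg[i]≡0 i = trans (sym (ℚ[x].coeff-scaleₚ (ι d) g i))
                          (trans (coeff≡ dg≈G₀ i) (trans (coeff-embed G₀ i) (cong ι (ℤ[x].coeff≡ G₀≈[] i))))
    ... | k , G , G₀≈kG , primG = 1/ ι d ℚ.* ι k , G , g≈ , primG
      where
      instance _ = ℚ.≢-nonZero (ι-≢0 d≢0)
      g≈ : g ≈ scaleₚ (1/ ι d ℚ.* ι k) (embed G)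
      g≈ = begin
        g                                         ≈⟨ ℚ[x].scaleₚ-𝟙 g ⟨
        scaleₚ 1ℚ g                               ≡⟨ cong (λ x → scaleₚ x g) (ℚ.*-inverseˡ (ι d)) ⟨
        scaleₚ (1/ ι d ℚ.* ι d) g                 ≈⟨ ℚ[x].scaleₚ-scaleₚ (1/ ι d) (ι d) g ⟨
        scaleₚ (1/ ι d) (scaleₚ (ι d) g)          ≈⟨ ℚ[x].scaleₚ-cong {1/ ι d} refl dg≈G₀ ⟩
        scaleₚ (1/ ι d) (embed G₀)                ≈⟨ ℚ[x].scaleₚ-cong {1/ ι d} refl (embed-cong G₀≈kG) ⟩
        scaleₚ (1/ ι d) (embed (ℤ[x].scaleₚ k G)) ≡⟨ cong (scaleₚ (1/ ι d)) (embed-scaleₚ k G) ⟩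
        scaleₚ (1/ ι d) (scaleₚ (ι k) (embed G))  ≈⟨ ℚ[x].scaleₚ-scaleₚ (1/ ι d) (ι k) (embed G) ⟩
        scaleₚ (1/ ι d ℚ.* ι k) (embed G)         ∎
        where open import Relation.Binary.Reasoning.Setoid ℚ[x].≈-setoid

    ℘∤numerator-or-denominator : ∀ r → ¬ (℘∣ (↥ r) × ℘∣ (+ ↧ₙ r))
    ℘∤numerator-or-denominator r@(mkℚ _ _ coprime) (℘∣↥r , ℘∣↧r) =
      ℕ.nonTrivial⇒≢1 {{prime⇒nonTrivial ℘-prime}} (ℕ.recompute coprime (∣⇒∣ᵤ ℘∣↥r , ∣⇒∣ᵤ ℘∣↧r))

    eisenstein-over-ℚ : ∀ {F n g h} → IsEisenstein F n → embed F ≈ g *ₚ h → IntegralForm g → IntegralForm h →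
                        IsConstant g ⊎ IsConstant h
    eisenstein-over-ℚ {F} {g = g} {h} eis F≈gh (a , G , g≈aG , primG) (b , H , h≈bH , primH) =
      Sum.map (IsConstant-scaleₚ-embed a G g≈aG) (IsConstant-scaleₚ-embed b H h≈bH)
        (eisenstein {G = G} {H} eis primG primH (℘∤numerator-or-denominator (a ℚ.* b)) (cross-multiply (a ℚ.* b) F≈abGH))
      where
      F≈abGH : embed F ≈ scaleₚ (a ℚ.* b) (embed (G ℤ[x].*ₚ H))
      F≈abGH = begin
        embed F                                     ≈⟨ F≈gh ⟩
        g *ₚ h                                      ≈⟨ ℚ[x].*ₚ-cong g≈aG h≈bH ⟩
        scaleₚ a (embed G) *ₚ scaleₚ b (embed H)    ≈⟨ ℚ[x].scaleₚ-*ₚ-scaleₚ a b (embed G) (embed H) ⟩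
        scaleₚ (a ℚ.* b) (embed G *ₚ embed H)       ≡⟨ cong (scaleₚ (a ℚ.* b)) (embed-*ₚ G H) ⟨
        scaleₚ (a ℚ.* b) (embed (G ℤ[x].*ₚ H))      ∎
        where open import Relation.Binary.Reasoning.Setoid ℚ[x].≈-setoid

    eisenstein-irreducible : ∀ {F n} → IsEisenstein F n → Irreducible (embed F)
    eisenstein-irreducible {F} {n} eis = ¬unit , factors
      where
      open IsEisenstein eis using (positive-degree; leading-indivisible)
      F[n]≢0 : coeff (embed F) n ≢ 0ℚ
      F[n]≢0 = ι-≢0 (℘∤⇒≢0 leading-indivisible) ∘ trans (sym (coeff-embed F n))
      ¬unit : ¬ IsUnit (embed F)
      ¬unit unit = F[n]≢0 (ℚ[x]-Domain.unit⇒constant (embed F) unit n positive-degree)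
      factors : ∀ g h → embed F ≈ g *ₚ h → IsUnit g ⊎ IsUnit h
      factors g h F≈gh =
        Sum.map (constant⇒unit g g≉[]) (constant⇒unit h h≉[])
          (eisenstein-over-ℚ eis F≈gh (integral-form g g≉[]) (integral-form h h≉[]))
        where
        g≉[] : ¬ g ≈ []
        g≉[] g≈[] = F[n]≢0 (coeff≡ (≈-trans F≈gh (ℚ[x].*ₚ-congˡ h g≈[])) n)
        h≉[] : ¬ h ≈ []
        h≉[] h≈[] = F[n]≢0 (coeff≡ (≈-trans F≈gh (≈-trans (ℚ[x].*ₚ-congʳ g h≈[]) (ℚ[x].*ₚ-zeroʳ g))) n)

open RationalFactorisation

module ShiftedK where
  open ℤ[x] using (Poly; coeff; _≈_; _+ₚ_; _*ₚ_; _^ₚ_; -ₚ_; constₚ; 1ₚ; Xₚ; Degree≤; _^_; ≈-refl; ≈-sym)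

  X-1 2-X : Poly
  X-1 = -[1+ 0 ] ∷ + 1 ∷ []
  2-X = + 2 ∷ -[1+ 0 ] ∷ []

  shiftedK : ℕ → Poly
  shiftedK n = X-1 ^ₚ n +ₚ 2-X ^ₚ n +ₚ 1ₚ

  X-1^3^a : ∀ a → X-1 ^ₚ (3 ℕ.^ a) ≈ Xₚ ^ₚ (3 ℕ.^ a) +ₚ constₚ -[1+ 0 ] [mod + 3 ]
  X-1^3^a a = ≈mod-trans (freshmans-dream a Xₚ (constₚ -[1+ 0 ]))
    (+ₚ-cong-mod (≈⇒≈mod ≈-refl) (fermat a (≈⇒≈mod ≈-refl)))

  2-X^3^a : ∀ a → 2-X ^ₚ (3 ℕ.^ a) ≈ constₚ (+ 2) +ₚ constₚ -[1+ 0 ] *ₚ Xₚ ^ₚ (3 ℕ.^ a) [mod + 3 ]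
  2-X^3^a a = ≈mod-trans (freshmans-dream a (constₚ (+ 2)) (constₚ -[1+ 0 ] *ₚ Xₚ))
    (+ₚ-cong-mod (fermat a (mk≈mod (constₚ (+ 2)) ≈-refl))
                 (≈mod-trans (≈⇒≈mod (ℤ[x].^ₚ-distrib-*ₚ (constₚ -[1+ 0 ]) Xₚ (3 ℕ.^ a)))
                             (*ₚ-cong-mod (fermat a (≈⇒≈mod ≈-refl)) (≈⇒≈mod ≈-refl))))

  shiftedK-mod-3 : ∀ a b → shiftedK (3 ℕ.^ a ℕ.+ 3 ℕ.^ b) ≈ constₚ (+ 2) *ₚ Xₚ ^ₚ (3 ℕ.^ a ℕ.+ 3 ℕ.^ b) [mod + 3 ]
  shiftedK-mod-3 a b =
    ≈mod-trans (+ₚ-cong-mod (+ₚ-cong-mod (≈mod-trans (≈⇒≈mod (ℤ[x].^ₚ-+ X-1 u v)) (*ₚ-cong-mod (X-1^3^a a) (X-1^3^a b)))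
                                         (≈mod-trans (≈⇒≈mod (ℤ[x].^ₚ-+ 2-X u v)) (*ₚ-cong-mod (2-X^3^a a) (2-X^3^a b))))
                            (≈⇒≈mod (≈-refl {1ₚ})))
    (≈mod-trans (mk≈mod (constₚ (+ 2) +ₚ -ₚ U +ₚ -ₚ V) (expand U V))
                (≈⇒≈mod (ℤ[x].*ₚ-congʳ (constₚ (+ 2)) (≈-sym (ℤ[x].^ₚ-+ Xₚ u v)))))
    where
    open ℤ[x]-Solver using (solve; _:=_; con; _:+_; _:*_; :-_)
    u = 3 ℕ.^ a
    v = 3 ℕ.^ b
    U = Xₚ ^ₚ u
    V = Xₚ ^ₚ v
    expand : ∀ U V → (U +ₚ constₚ -[1+ 0 ]) *ₚ (V +ₚ constₚ -[1+ 0 ])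
                     +ₚ (constₚ (+ 2) +ₚ constₚ -[1+ 0 ] *ₚ U) *ₚ (constₚ (+ 2) +ₚ constₚ -[1+ 0 ] *ₚ V) +ₚ 1ₚ
                   ≈ constₚ (+ 2) *ₚ (U *ₚ V) +ₚ constₚ (+ 3) *ₚ (constₚ (+ 2) +ₚ -ₚ U +ₚ -ₚ V)
    expand = solve 2 (λ U V → (U :+ con -[1+ 0 ]) :* (V :+ con -[1+ 0 ])
                              :+ (con (+ 2) :+ con -[1+ 0 ] :* U) :* (con (+ 2) :+ con -[1+ 0 ] :* V) :+ con (+ 1)
                            := con (+ 2) :* (U :* V) :+ con (+ 3) :* (con (+ 2) :+ (:- U) :+ (:- V))) ≈-refl

  3-prime : Prime 3
  3-prime = from-yes (prime? 3)

  open Eisenstein 3 3-prime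

  X-1-degree≤1 : Degree≤ X-1 1
  X-1-degree≤1 (suc zero) (s≤s ())
  X-1-degree≤1 (suc (suc i)) _ = refl

  2-X-degree≤1 : Degree≤ 2-X 1
  2-X-degree≤1 (suc zero) (s≤s ())
  2-X-degree≤1 (suc (suc i)) _ = refl

  coeff-shiftedK : ∀ n k → coeff (shiftedK n) k ≡ (coeff (X-1 ^ₚ n) k ℤ.+ coeff (2-X ^ₚ n) k) ℤ.+ coeff 1ₚ k
  coeff-shiftedK n k = trans (ℤ[x].coeff-+ₚ (X-1 ^ₚ n +ₚ 2-X ^ₚ n) 1ₚ k)
                             (cong (ℤ._+ coeff 1ₚ k) (ℤ[x].coeff-+ₚ (X-1 ^ₚ n) (2-X ^ₚ n) k))

  shiftedK-degree≤ : ∀ n → Degree≤ (shiftedK n) n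
  shiftedK-degree≤ n (suc k) n<k = trans (coeff-shiftedK n (suc k))
    (cong (ℤ._+ 0ℤ) (cong₂ ℤ._+_ (proj₁ (ℤ[x].^ₚ-leading X-1 X-1-degree≤1 n) (suc k) n<k)
                                 (proj₁ (ℤ[x].^ₚ-leading 2-X 2-X-degree≤1 n) (suc k) n<k)))

  coeff-shiftedK-leading : ∀ n → 0 < n → coeff (shiftedK n) n ≡ 1ℤ ℤ.+ -[1+ 0 ] ^ n
  coeff-shiftedK-leading n@(suc _) _ = trans (coeff-shiftedK n n)
    (trans (ℤ.+-identityʳ _) (cong₂ ℤ._+_ (trans (proj₂ (ℤ[x].^ₚ-leading X-1 X-1-degree≤1 n)) (ℤ[x].𝟙^n≡𝟙 n))
                                          (proj₂ (ℤ[x].^ₚ-leading 2-X 2-X-degree≤1 n))))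

  coeff-shiftedK-0 : ∀ n → coeff (shiftedK n) 0 ≡ (-[1+ 0 ] ^ n ℤ.+ (+ 2) ^ n) ℤ.+ 1ℤ
  coeff-shiftedK-0 n = trans (coeff-shiftedK n 0) (cong (ℤ._+ 1ℤ) (cong₂ ℤ._+_ (ℤ[x].coeff-^ₚ-0 X-1 n) (ℤ[x].coeff-^ₚ-0 2-X n)))

  ^-6* : ∀ x m → x ^ (6 ℕ.* m) ≡ (x ^ 6) ^ m
  ^-6* x m = trans (cong (x ^_) (ℕ.*-comm 6 m)) (ℤ[x].^-* x 6 m)

  64^m≡1+9t : ∀ m → Σ ℤ λ t → (+ 64) ^ m ≡ 1ℤ ℤ.+ + 9 ℤ.* t
  64^m≡1+9t zero = 0ℤ , refl
  64^m≡1+9t (suc m) with 64^m≡1+9t m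
  ... | t , 64^m≡ = + 7 ℤ.+ + 64 ℤ.* t , trans (cong (+ 64 ℤ.*_) 64^m≡)
    (solve 1 (λ t → con (+ 64) :* (con 1ℤ :+ con (+ 9) :* t) := con 1ℤ :+ con (+ 9) :* (con (+ 7) :+ con (+ 64) :* t)) refl t)
    where open ℤ-Solver.+-*-Solver

  [-1]^6m≡1 : ∀ m → -[1+ 0 ] ^ (6 ℕ.* m) ≡ 1ℤ
  [-1]^6m≡1 m = trans (^-6* -[1+ 0 ] m) (ℤ[x].𝟙^n≡𝟙 m)

  3∤2 : ¬ ℘∣ (+ 2)
  3∤2 3∣2 with ℕ∣.∣⇒≤ (∣⇒∣ᵤ 3∣2)
  ... | s≤s (s≤s ())

  9∤3+9t : ∀ t → ¬ (+ 9 ∣ℤ + 3 ℤ.+ + 9 ℤ.* t)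
  9∤3+9t t 9∣3+9t with ℕ∣.∣⇒≤ (∣⇒∣ᵤ (ℤ∣.∣m+n∣n⇒∣m {m = + 3} 9∣3+9t (ℤ∣.∣m⇒∣m*n t ℤ∣.∣-refl)))
  ... | s≤s (s≤s (s≤s ()))

  3^a+3^b>0 : ∀ a b → 0 < 3 ℕ.^ a ℕ.+ 3 ℕ.^ b
  3^a+3^b>0 a b = ℕ.<-≤-trans (ℕ.m^n>0 3 a) (ℕ.m≤m+n (3 ℕ.^ a) (3 ℕ.^ b))

  shiftedK-eisenstein : ∀ a b m → 6 ℕ.* m ≡ 3 ℕ.^ a ℕ.+ 3 ℕ.^ b → IsEisenstein (shiftedK (6 ℕ.* m)) (6 ℕ.* m)
  shiftedK-eisenstein a b m n≡ = record
    { positive-degree = 0<n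
    ; degree≤ = shiftedK-degree≤ n
    ; leading-indivisible = 3∤2 ∘ subst ℘∣_ (trans (coeff-shiftedK-leading n 0<n) (cong (λ x → 1ℤ ℤ.+ x) ([-1]^6m≡1 m)))
    ; lower-divisible = λ k k<n → ≈mod-coeff-∣ shiftedK≈2Xⁿ k (subst ℘∣_ (sym (2Xⁿ[k]≡0 k (ℕ.<⇒≢ k<n))) ℘∣0)
    ; constant-not-℘²-divisible = 9∤3+9t t ∘ subst (+ 9 ∣ℤ_) constant≡3+9t
    }
    where
    n = 6 ℕ.* m
    0<n : 0 < n
    0<n = subst (0 <_) (sym n≡) (3^a+3^b>0 a b)
    shiftedK≈2Xⁿ : shiftedK n ≈ constₚ (+ 2) *ₚ Xₚ ^ₚ n [mod + 3 ]
    shiftedK≈2Xⁿ = subst (λ N → shiftedK N ≈ constₚ (+ 2) *ₚ Xₚ ^ₚ N [mod + 3 ]) (sym n≡) (shiftedK-mod-3 a b)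
    2Xⁿ[k]≡0 : ∀ k → k ≢ n → coeff (constₚ (+ 2) *ₚ Xₚ ^ₚ n) k ≡ 0ℤ
    2Xⁿ[k]≡0 k k≢n = trans (ℤ[x].coeff-constₚ-*ₚ (+ 2) (Xₚ ^ₚ n) k) (cong (+ 2 ℤ.*_) (ℤ[x].coeff-Xₚ^ₚ-≢ n k k≢n))
    t = proj₁ (64^m≡1+9t m)
    constant≡3+9t : coeff (shiftedK n) 0 ≡ + 3 ℤ.+ + 9 ℤ.* t
    constant≡3+9t = begin
      coeff (shiftedK n) 0                                ≡⟨ coeff-shiftedK-0 n ⟩
      (-[1+ 0 ] ^ n ℤ.+ (+ 2) ^ n) ℤ.+ 1ℤ   ≡⟨ cong₂ (λ x y → (x ℤ.+ y) ℤ.+ 1ℤ) ([-1]^6m≡1 m) (^-6* (+ 2) m) ⟩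
      (1ℤ ℤ.+ (+ 64) ^ m) ℤ.+ 1ℤ            ≡⟨ cong (λ x → (1ℤ ℤ.+ x) ℤ.+ 1ℤ) (proj₂ (64^m≡1+9t m)) ⟩
      (1ℤ ℤ.+ (1ℤ ℤ.+ + 9 ℤ.* t)) ℤ.+ 1ℤ    ≡⟨ collect ⟩
      + 3 ℤ.+ + 9 ℤ.* t                     ∎
      where
      open ≡-Reasoning
      open ℤ-Solver.+-*-Solver
      collect : (1ℤ ℤ.+ (1ℤ ℤ.+ + 9 ℤ.* t)) ℤ.+ 1ℤ ≡ + 3 ℤ.+ + 9 ℤ.* t
      collect = solve 1 (λ t → (con 1ℤ :+ (con 1ℤ :+ con (+ 9) :* t)) :+ con 1ℤ := con (+ 3) :+ con (+ 9) :* t) refl t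

open ShiftedK

open ℚ[x] hiding (Irreducible; _^_)
open import Defs using (Irreducible; K)
open import Data.Nat using (_+_; _*_; _^_)
open import Data.Nat.Divisibility using (_∣_)

coeff≡coeff : ∀ p i → Defs.coeff p i ≡ coeff p i
coeff≡coeff [] i = refl
coeff≡coeff (a ∷ p) zero = refl
coeff≡coeff (a ∷ p) (suc i) = coeff≡coeff p i

+ₚ≡+ₚ : ∀ p q → p Defs.+ₚ q ≡ p +ₚ q
+ₚ≡+ₚ [] q = refl
+ₚ≡+ₚ (a ∷ p) [] = refl
+ₚ≡+ₚ (a ∷ p) (b ∷ q) = cong (_ ∷_) (+ₚ≡+ₚ p q)

*ₚ≡*ₚ : ∀ p q → p Defs.*ₚ q ≡ p *ₚ q
*ₚ≡*ₚ [] q = refl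
*ₚ≡*ₚ (a ∷ p) q = trans (+ₚ≡+ₚ (Defs.scaleₚ a q) (0ℚ ∷ (p Defs.*ₚ q)))
  (cong (λ r → scaleₚ a q +ₚ (0ℚ ∷ r)) (*ₚ≡*ₚ p q))

^ₚ≡^ₚ : ∀ p n → p Defs.^ₚ n ≡ p ^ₚ n
^ₚ≡^ₚ p zero = refl
^ₚ≡^ₚ p (suc n) = trans (*ₚ≡*ₚ p (p Defs.^ₚ n)) (cong (p *ₚ_) (^ₚ≡^ₚ p n))

≈ₚ⇒≈ : ∀ {p q} → p Defs.≈ₚ q → p ≈ q
≈ₚ⇒≈ {p} {q} e = mk≈ λ i → trans (sym (coeff≡coeff p i)) (trans (e i) (coeff≡coeff q i))

≈⇒≈ₚ : ∀ {p q} → p ≈ q → p Defs.≈ₚ q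
≈⇒≈ₚ {p} {q} e i = trans (coeff≡coeff p i) (trans (coeff≡ e i) (sym (coeff≡coeff q i)))

IsUnit⇒IsUnit : ∀ g → IsUnit g → Defs.IsUnit g
IsUnit⇒IsUnit g (r , gr≈1) = r , ≈⇒≈ₚ (subst (_≈ 1ₚ) (sym (*ₚ≡*ₚ g r)) gr≈1)

Irreducible⇒Irreducible : ∀ f → ℚ[x].Irreducible f → Irreducible f
Irreducible⇒Irreducible f (¬unit , factors) = ¬unit′ , factors′
  where
  ¬unit′ : ¬ Defs.IsUnit f
  ¬unit′ (r , fr≈1) = ¬unit (r , subst (_≈ 1ₚ) (*ₚ≡*ₚ f r) (≈ₚ⇒≈ fr≈1))
  factors′ : ∀ g h → f Defs.≈ₚ g Defs.*ₚ h → Defs.IsUnit g Sum.⊎ Defs.IsUnit h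
  factors′ g h f≈gh = Sum.map (IsUnit⇒IsUnit g) (IsUnit⇒IsUnit h)
    (factors g h (subst (f ≈_) (*ₚ≡*ₚ g h) (≈ₚ⇒≈ f≈gh)))

1-X : Poly
1-X = 1ₚ +ₚ scaleₚ (ℚ.- 1ℚ) Xₚ

Kℚ : ℕ → Poly
Kℚ n = Xₚ ^ₚ n +ₚ 1-X ^ₚ n +ₚ 1ₚ

K≡Kℚ : ∀ n → K n ≡ Kℚ n
K≡Kℚ n = begin
  Defs.Xₚ Defs.^ₚ n Defs.+ₚ 1-X′ Defs.^ₚ n Defs.+ₚ Defs.oneₚ
    ≡⟨ trans (+ₚ≡+ₚ _ Defs.oneₚ) (cong (_+ₚ 1ₚ) (+ₚ≡+ₚ (Defs.Xₚ Defs.^ₚ n) _)) ⟩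
  Defs.Xₚ Defs.^ₚ n +ₚ 1-X′ Defs.^ₚ n +ₚ 1ₚ
    ≡⟨ cong₂ (λ x y → x +ₚ y +ₚ 1ₚ) (^ₚ≡^ₚ Xₚ n) (^ₚ≡^ₚ 1-X′ n) ⟩
  Xₚ ^ₚ n +ₚ 1-X′ ^ₚ n +ₚ 1ₚ
    ≡⟨ cong (λ x → Xₚ ^ₚ n +ₚ x ^ₚ n +ₚ 1ₚ) (+ₚ≡+ₚ Defs.oneₚ (Defs.scaleₚ (ℚ.- 1ℚ) Defs.Xₚ)) ⟩
  Kℚ n
    ∎
  where
  open ≡-Reasoning
  1-X′ = Defs.oneₚ Defs.+ₚ Defs.scaleₚ (ℚ.- 1ℚ) Defs.Xₚ

X+1 : Poly
X+1 = 1ℚ ∷ 1ℚ ∷ []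

X-1∘X+1≈X : embed X-1 ∘ₚ X+1 ≈ Xₚ
X-1∘X+1≈X = mk≈ λ { 0 → refl ; 1 → refl ; 2 → refl ; (suc (suc (suc i))) → refl }

1-X∘X-1≈2-X : 1-X ∘ₚ embed X-1 ≈ embed 2-X
1-X∘X-1≈2-X = mk≈ λ { 0 → refl ; 1 → refl ; 2 → refl ; (suc (suc (suc i))) → refl }

embed-shiftedK : ∀ n → embed (shiftedK n) ≡ embed X-1 ^ₚ n +ₚ embed 2-X ^ₚ n +ₚ 1ₚ
embed-shiftedK n = trans (embed-+ₚ (X-1 ℤ[x].^ₚ n ℤ[x].+ₚ 2-X ℤ[x].^ₚ n) ℤ[x].1ₚ)
  (cong (_+ₚ 1ₚ) (trans (embed-+ₚ (X-1 ℤ[x].^ₚ n) (2-X ℤ[x].^ₚ n)) (cong₂ _+ₚ_ (embed-^ₚ X-1 n) (embed-^ₚ 2-X n))))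

Kℚ∘X-1≈shiftedK : ∀ n → Kℚ n ∘ₚ embed X-1 ≈ embed (shiftedK n)
Kℚ∘X-1≈shiftedK n = begin
  (Xₚ ^ₚ n +ₚ 1-X ^ₚ n +ₚ 1ₚ) ∘ₚ s
    ≈⟨ ≈-trans (+ₚ-∘ₚ (Xₚ ^ₚ n +ₚ 1-X ^ₚ n) 1ₚ s) (+ₚ-cong (+ₚ-∘ₚ (Xₚ ^ₚ n) (1-X ^ₚ n) s) (constₚ-∘ₚ 1ℚ s)) ⟩
  (Xₚ ^ₚ n) ∘ₚ s +ₚ (1-X ^ₚ n) ∘ₚ s +ₚ 1ₚ
    ≈⟨ +ₚ-cong (+ₚ-cong (^ₚ-∘ₚ Xₚ n s) (^ₚ-∘ₚ 1-X n s)) ≈-refl ⟩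
  (Xₚ ∘ₚ s) ^ₚ n +ₚ (1-X ∘ₚ s) ^ₚ n +ₚ 1ₚ
    ≈⟨ +ₚ-cong (+ₚ-cong (^ₚ-cong n (Xₚ-∘ₚ s)) (^ₚ-cong n 1-X∘X-1≈2-X)) ≈-refl ⟩
  embed X-1 ^ₚ n +ₚ embed 2-X ^ₚ n +ₚ 1ₚ
    ≡⟨ embed-shiftedK n ⟨
  embed (shiftedK n)
    ∎
  where
  open import Relation.Binary.Reasoning.Setoid ≈-setoid
  s = embed X-1

mainTheorem17 : (a b : ℕ) → 1 ≤ a → 1 ≤ b → 6 ∣ 3 ^ a + 3 ^ b →
    (m : ℕ) → 6 * m ≡ 3 ^ a + 3 ^ b → Irreducible (K (6 * m))
mainTheorem17 a b _ _ _ m n≡ = subst Irreducible (sym (K≡Kℚ n)) (Irreducible⇒Irreducible (Kℚ n) Kℚ-irreducible)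
  where
  n = 6 * m
  shiftedK-irreducible : ℚ[x].Irreducible (embed (shiftedK n))
  shiftedK-irreducible = EisensteinOverℚ.eisenstein-irreducible 3 3-prime (shiftedK-eisenstein a b m n≡)
  Kℚ-irreducible : ℚ[x].Irreducible (Kℚ n)
  Kℚ-irreducible = irreducible-∘ₚ⁻ (embed X-1) X+1 X-1∘X+1≈X
    (Irreducible-resp-≈ (≈-sym (Kℚ∘X-1≈shiftedK n)) shiftedK-irreducible)
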